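{- Let $r\geq 3$ be an integer and let $G$ be a finite simple $K_{1,r}$-free graph. If $\delta(G)\geq \left\lfloor\frac{r}{2}\right\rfloor+1$, then $G$ is a $\mathcal{P}_{\geq 2}$-factor covered graph, i.e., for every edge $e\in E(G)$ there is a $\mathcal{P}_{\geq 2}$-factor of $G$ containing $e$.
   Context: All graphs are finite and simple. $\delta(G)$ is the minimum degree of $G$. $K_{1,r}$ denotes the star with one center vertex adjacent to $r$ leaves; $G$ is $K_{1,r}$-free if it contains no induced subgraph isomorphic to $K_{1,r}$. For an integer $k\geq 2$, a $\mathcal{P}_{\geq k}$-factor of $G$ is a spanning subgraph of $G$ every connected component of which is a path with at least $k$ vertices. $G$ is a $\mathcal{P}_{\geq k}$-factor covered graph if for every $e\in E(G)$ there is a $\mathcal{P}_{\geq k}$-factor of $G$ whose edge set contains $e$. -}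

module Defs where

open import Data.Nat using (ℕ; _≤_; _<_)
open import Data.Bool using (Bool; true; false)
open import Data.Fin using (Fin)
open import Data.List using (List; []; _∷_; _++_; length; concat; filterᵇ)
open import Data.List.Relation.Unary.All using (All)
open import Data.List.Relation.Unary.Any using (Any)
open import Data.List.Relation.Unary.Linked using (Linked)
open import Data.List.Relation.Binary.Permutation.Propositional using (_↭_)
open import Data.Fin.Base using ()
open import Data.List.Base using (allFin)
open import Data.Product using (Σ; ∃; _×_)
open import Data.Sum using (_⊎_)
open import Relation.Binary.PropositionalEquality using (_≡_; _≢_)
open import Relation.Nullary using (¬_)

record Graph (n : ℕ) : Set where
  field
    adj     : Fin n → Fin n → Bool
    sym     : ∀ u v → adj u v ≡ adj v u
    irrefl  : ∀ v → adj v v ≡ false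

open Graph public

Adj : ∀ {n} → Graph n → Fin n → Fin n → Set
Adj G u v = adj G u v ≡ true

degree : ∀ {n} → Graph n → Fin n → ℕ
degree {n} G v = length (filterᵇ (adj G v) (allFin n))

MinDegreeAtLeast : ∀ {n} → Graph n → ℕ → Set
MinDegreeAtLeast {n} G d = ∀ (v : Fin n) → d ≤ degree G v

record InducedStar {n} (G : Graph n) (r : ℕ) : Set where
  field
    centre      : Fin n
    leaf        : Fin r → Fin n
    leaf-inj    : ∀ i j → i ≢ j → leaf i ≢ leaf j
    leaf-adj    : ∀ i → Adj G centre (leaf i)
    leaf-indep  : ∀ i j → ¬ Adj G (leaf i) (leaf j)

K1r-Free : ∀ {n} → Graph n → ℕ → Set
K1r-Free G r = ¬ InducedStar G r

-- A path of G with at least k vertices, given as its vertex sequence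
-- (consecutive vertices adjacent in G; distinctness of vertices is
-- enforced globally by the factor condition below).
record PathAtLeast {n} (G : Graph n) (k : ℕ) (p : List (Fin n)) : Set where
  field
    long   : k ≤ length p
    linked : Linked (Adj G) p

EdgeOfPath : ∀ {n} → Fin n → Fin n → List (Fin n) → Set
EdgeOfPath u v p = ∃ λ xs → ∃ λ ys → p ≡ xs ++ (u ∷ v ∷ ys)

-- A P_{≥k}-factor of G: a family of paths of G, each with at least k
-- vertices, whose vertex sets partition V(G) (the concatenation of the
-- vertex sequences is a permutation of all vertices).
record PathFactor {n} (G : Graph n) (k : ℕ) : Set where
  field
    paths    : List (List (Fin n))
    valid    : All (PathAtLeast G k) paths
    spanning : concat paths ↭ allFin n

FactorContainsEdge : ∀ {n} {G : Graph n} {k} → PathFactor G k → Fin n → Fin n → Set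
FactorContainsEdge F u v =
  Any (λ p → EdgeOfPath u v p ⊎ EdgeOfPath v u p) (PathFactor.paths F)

FactorCovered : ∀ {n} → Graph n → ℕ → Set
FactorCovered G k =
  ∀ u v → Adj G u v → Σ (PathFactor G k) λ F → FactorContainsEdge F u v

-- Fix an edge uv.  If |X| + 2 ≤ 2 |N(X)| for every nonempty vertex set X, then Hall's
-- theorem, applied with every vertex usable twice, gives a map f with x ~ f(x) for all x,
-- f(u) = v, f(v) = u, and every vertex hit at most twice.  In a K_{1,r}-free graph of
-- minimum degree ⌊r/2⌋ + 1 that inequality holds: the vertices of X without neighbours
-- in X form an independent set I, each vertex of N(X) ∖ X sees at most r − 1 of them, and
-- double counting the edges between I and N(X) ∖ X gives |I| + 2 ≤ 2 |N(X) ∖ X|.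
-- The functional graph of f is then cut into paths on at least two vertices, one of them
-- through uv: a vertex all of whose children are leaves is removed together with them;
-- when there is no such vertex, the non-leaves form disjoint cycles each carrying at most
-- one pendant leaf, and a path on two to four vertices can be removed after redirecting
-- at most one arc.

module Submission where

open import Defs hiding (sym)
open import Data.Nat using (ℕ; zero; suc; _+_; _*_; _≤_; _<_; z≤n; s≤s; _≤?_; _/_; _%_; >-nonZero)
open import Data.Nat.Properties
open import Data.Nat.DivMod using (m≡m%n+[m/n]*n; m%n<n; /-monoˡ-≤)
open import Data.Nat.Induction using (<-wellFounded)
open import Data.Fin using (Fin; zero; suc)
import Data.Fin.Properties as Finₚ
open import Data.Product using (Σ; ∃; _×_; _,_; proj₁; proj₂)
open import Data.Sum using (_⊎_; inj₁; inj₂; [_,_]′)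
open import Data.Empty using (⊥-elim)
open import Function using (_∘_)
open import Induction.WellFounded using (Acc; acc)
open import Relation.Nullary using (¬_; Dec; yes; no)
open import Relation.Binary.PropositionalEquality

AtMostTwoToOne : ∀ {A B : Set} → (A → B) → Set
AtMostTwoToOne f = ∀ {a b c} → f a ≡ f b → f b ≡ f c → a ≡ b ⊎ b ≡ c ⊎ a ≡ c

AtMostTwoToOneOn : ∀ {A B : Set} → (A → Set) → (A → B) → Set
AtMostTwoToOneOn S f = ∀ {a b c} → S a → S b → S c → f a ≡ f b → f b ≡ f c → a ≡ b ⊎ b ≡ c ⊎ a ≡ c

module _ {n} (G : Graph n) where

  Adj-sym : ∀ {x y} → Adj G x y → Adj G y x
  Adj-sym {x} {y} = trans (Graph.sym G y x)

  Adj⇒≢ : ∀ {x y} → Adj G x y → x ≢ y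
  Adj⇒≢ {x} x~x refl with trans (sym x~x) (irrefl G x)
  ... | ()

  record ParentMap (u v : Fin n) : Set where
    field
      parent     : Fin n → Fin n
      parent-adj : ∀ x → Adj G x (parent x)
      parent-u   : parent u ≡ v
      parent-v   : parent v ≡ u
      parent-≤2  : AtMostTwoToOne parent

module Hall where

  open import Data.Fin using (splitAt; join)
  open import Data.Fin.Subset
  open import Data.Fin.Subset.Properties
  open import Data.Vec using ([]; _∷_; here; there; _++_)
  open import Data.Vec.Functional using (updateAt)
  open import Data.Vec.Functional.Properties using (updateAt-updates; updateAt-minimal)
  open import Algebra.Properties.Semiring.Sum +-*-semiring using (sum)
  open import Data.Sum using (reduce; map; map₁)

  ∣p∪q∣+∣p∩q∣≡∣p∣+∣q∣ : ∀ {n} (p q : Subset n) → ∣ p ∪ q ∣ + ∣ p ∩ q ∣ ≡ ∣ p ∣ + ∣ q ∣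
  ∣p∪q∣+∣p∩q∣≡∣p∣+∣q∣ []            []            = refl
  ∣p∪q∣+∣p∩q∣≡∣p∣+∣q∣ (inside ∷ p)  (inside ∷ q)  =
    cong suc (trans (+-suc _ _) (trans (cong suc (∣p∪q∣+∣p∩q∣≡∣p∣+∣q∣ p q)) (sym (+-suc _ _))))
  ∣p∪q∣+∣p∩q∣≡∣p∣+∣q∣ (inside ∷ p)  (outside ∷ q) = cong suc (∣p∪q∣+∣p∩q∣≡∣p∣+∣q∣ p q)
  ∣p∪q∣+∣p∩q∣≡∣p∣+∣q∣ (outside ∷ p) (inside ∷ q)  = trans (cong suc (∣p∪q∣+∣p∩q∣≡∣p∣+∣q∣ p q)) (sym (+-suc _ _))
  ∣p∪q∣+∣p∩q∣≡∣p∣+∣q∣ (outside ∷ p) (outside ∷ q) = ∣p∪q∣+∣p∩q∣≡∣p∣+∣q∣ p q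

  ∣p∣≡∣p─q∣+∣p∩q∣ : ∀ {n} (p q : Subset n) → ∣ p ∣ ≡ ∣ p ─ q ∣ + ∣ p ∩ q ∣
  ∣p∣≡∣p─q∣+∣p∩q∣ []            []            = refl
  ∣p∣≡∣p─q∣+∣p∩q∣ (inside ∷ p)  (inside ∷ q)  = trans (cong suc (∣p∣≡∣p─q∣+∣p∩q∣ p q)) (sym (+-suc _ _))
  ∣p∣≡∣p─q∣+∣p∩q∣ (inside ∷ p)  (outside ∷ q) = cong suc (∣p∣≡∣p─q∣+∣p∩q∣ p q)
  ∣p∣≡∣p─q∣+∣p∩q∣ (outside ∷ p) (inside ∷ q)  = ∣p∣≡∣p─q∣+∣p∩q∣ p q
  ∣p∣≡∣p─q∣+∣p∩q∣ (outside ∷ p) (outside ∷ q) = ∣p∣≡∣p─q∣+∣p∩q∣ p q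

  x∈p⇒∣p∣≡1+∣p-x∣ : ∀ {n} {p : Subset n} {x} → x ∈ p → ∣ p ∣ ≡ suc ∣ p - x ∣
  x∈p⇒∣p∣≡1+∣p-x∣ {p = inside ∷ p}  here       = cong (suc ∘ ∣_∣) (sym (p─⊥≡p p))
  x∈p⇒∣p∣≡1+∣p-x∣ {p = inside ∷ p}  (there xp) = cong suc (x∈p⇒∣p∣≡1+∣p-x∣ xp)
  x∈p⇒∣p∣≡1+∣p-x∣ {p = outside ∷ p} (there xp) = x∈p⇒∣p∣≡1+∣p-x∣ xp

  x∈p─q⇒x∉q : ∀ {n} {p q : Subset n} {x} → x ∈ p ─ q → x ∉ q
  x∈p─q⇒x∉q {p = _ ∷ p}      {inside ∷ q}  {zero}  ()        here
  x∈p─q⇒x∉q {p = inside ∷ p} {outside ∷ q} {zero}  _         ()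
  x∈p─q⇒x∉q {p = _ ∷ p}      {_ ∷ q}       {suc x} (there h) (there h′) = x∈p─q⇒x∉q h h′

  x∈p-y⇒x≢y : ∀ {n} {p : Subset n} {x y} → x ∈ p - y → x ≢ y
  x∈p-y⇒x≢y {x = x} h refl = x∈p─q⇒x∉q h (x∈⁅x⁆ x)

  Empty⇒∣p∣≡0 : ∀ {n} {p : Subset n} → Empty p → ∣ p ∣ ≡ 0
  Empty⇒∣p∣≡0 {n} e = trans (cong ∣_∣ (Empty-unique e)) (∣⊥∣≡0 n)

  x∈p⇒1≤∣p∣ : ∀ {n} {p : Subset n} {x} → x ∈ p → 1 ≤ ∣ p ∣
  x∈p⇒1≤∣p∣ xp = ≤-trans (s≤s z≤n) (≤-reflexive (sym (x∈p⇒∣p∣≡1+∣p-x∣ xp)))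

  distinct⇒2≤∣p∣ : ∀ {n} {p : Subset n} {x y} → x ∈ p → y ∈ p → x ≢ y → 2 ≤ ∣ p ∣
  distinct⇒2≤∣p∣ xp yp x≢y =
    ≤-trans (s≤s (x∈p⇒1≤∣p∣ (x∈p∧x≢y⇒x∈p-y yp (x≢y ∘ sym)))) (≤-reflexive (sym (x∈p⇒∣p∣≡1+∣p-x∣ xp)))

  distinctMembers : ∀ {n} (p : Subset n) k → k ≤ ∣ p ∣ →
    Σ (Fin k → Fin n) λ g → (∀ i → g i ∈ p) × (∀ i j → i ≢ j → g i ≢ g j)
  distinctMembers p            zero    _       = (λ ()) , (λ ()) , (λ ())
  distinctMembers (outside ∷ p) (suc k) k<∣p∣ with distinctMembers p (suc k) k<∣p∣
  ... | g , g∈p , g-inj = suc ∘ g , there ∘ g∈p , λ i j i≢j → g-inj i j i≢j ∘ Finₚ.suc-injective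
  distinctMembers (inside ∷ p)  (suc k) (s≤s k≤∣p∣) with distinctMembers p k k≤∣p∣
  ... | g , g∈p , g-inj = g′ , g′∈ , g′-inj
    where
    g′ : Fin (suc k) → Fin _
    g′ zero    = zero
    g′ (suc i) = suc (g i)
    g′∈ : ∀ i → g′ i ∈ inside ∷ p
    g′∈ zero    = here
    g′∈ (suc i) = there (g∈p i)
    g′-inj : ∀ i j → i ≢ j → g′ i ≢ g′ j
    g′-inj zero    zero    i≢j = ⊥-elim (i≢j refl)
    g′-inj zero    (suc j) _   ()
    g′-inj (suc i) zero    _   ()
    g′-inj (suc i) (suc j) i≢j = g-inj i j (i≢j ∘ cong suc) ∘ Finₚ.suc-injective

  1≤∣p∣⇒Nonempty : ∀ {n} {p : Subset n} → 1 ≤ ∣ p ∣ → Nonempty p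
  1≤∣p∣⇒Nonempty {p = p} h with distinctMembers p 1 h
  ... | g , g∈p , _ = g zero , g∈p zero

  ∣p∣≤1⇒⊆⁅x⁆ : ∀ {n} {p : Subset n} {x} → ∣ p ∣ ≤ 1 → x ∈ p → p ⊆ ⁅ x ⁆
  ∣p∣≤1⇒⊆⁅x⁆ {x = x} ∣p∣≤1 xp {y} yp with y Finₚ.≟ x
  ... | yes refl = x∈⁅x⁆ x
  ... | no  y≢x  = ⊥-elim (<⇒≱ (s≤s ∣p∣≤1) (distinct⇒2≤∣p∣ yp xp y≢x))

  ∑-mono-≤ : ∀ {n} {f g : Fin n → ℕ} → (∀ i → f i ≤ g i) → sum f ≤ sum g
  ∑-mono-≤ {zero}  f≤g = z≤n
  ∑-mono-≤ {suc n} f≤g = +-mono-≤ (f≤g zero) (∑-mono-≤ (f≤g ∘ suc))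

  ∑-mono-< : ∀ {n} {f g : Fin n → ℕ} → (∀ i → f i ≤ g i) → ∀ i → f i < g i → sum f < sum g
  ∑-mono-< f≤g zero    fi<gi = +-mono-<-≤ fi<gi (∑-mono-≤ (f≤g ∘ suc))
  ∑-mono-< f≤g (suc i) fi<gi = +-mono-≤-< (f≤g zero) (∑-mono-< (f≤g ∘ suc) i fi<gi)

  _⟦_⟧ : ∀ {m k} → (Fin m → Subset k) → Subset m → Subset k
  A ⟦ []          ⟧ = ⊥
  A ⟦ inside ∷ X  ⟧ = A zero ∪ (A ∘ suc) ⟦ X ⟧
  A ⟦ outside ∷ X ⟧ = (A ∘ suc) ⟦ X ⟧

  ∈⟦⟧⁺ : ∀ {m k} (A : Fin m → Subset k) {X i y} → i ∈ X → y ∈ A i → y ∈ A ⟦ X ⟧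
  ∈⟦⟧⁺ A {inside ∷ X}  here       y∈Ai = x∈p∪q⁺ (inj₁ y∈Ai)
  ∈⟦⟧⁺ A {inside ∷ X}  (there i∈X) y∈Ai = x∈p∪q⁺ (inj₂ (∈⟦⟧⁺ (A ∘ suc) i∈X y∈Ai))
  ∈⟦⟧⁺ A {outside ∷ X} (there i∈X) y∈Ai = ∈⟦⟧⁺ (A ∘ suc) i∈X y∈Ai

  ∈⟦⟧⁻ : ∀ {m k} (A : Fin m → Subset k) X {y} → y ∈ A ⟦ X ⟧ → ∃ λ i → i ∈ X × y ∈ A i
  ∈⟦⟧⁻ A []            y∈ = ⊥-elim (∉⊥ y∈)
  ∈⟦⟧⁻ A (inside ∷ X)  y∈ with x∈p∪q⁻ (A zero) ((A ∘ suc) ⟦ X ⟧) y∈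
  ... | inj₁ y∈A0 = zero , here , y∈A0
  ... | inj₂ y∈AX with ∈⟦⟧⁻ (A ∘ suc) X y∈AX
  ...   | i , i∈X , y∈Ai = suc i , there i∈X , y∈Ai
  ∈⟦⟧⁻ A (outside ∷ X) y∈ with ∈⟦⟧⁻ (A ∘ suc) X y∈
  ... | i , i∈X , y∈Ai = suc i , there i∈X , y∈Ai

  ⟦⟧-mono : ∀ {m k} {A B : Fin m → Subset k} X → (∀ {i} → i ∈ X → A i ⊆ B i) → A ⟦ X ⟧ ⊆ B ⟦ X ⟧
  ⟦⟧-mono {A = A} {B} X A⊆B y∈ with ∈⟦⟧⁻ A X y∈
  ... | i , i∈X , y∈Ai = ∈⟦⟧⁺ B i∈X (A⊆B i∈X y∈Ai)

  ⟦⁅i⁆⟧⊆ : ∀ {m k} (A : Fin m → Subset k) i → A ⟦ ⁅ i ⁆ ⟧ ⊆ A i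
  ⟦⁅i⁆⟧⊆ A i y∈ with ∈⟦⟧⁻ A ⁅ i ⁆ y∈
  ... | j , j∈⁅i⁆ , y∈Aj = subst (λ j → _ ∈ A j) (x∈⁅y⁆⇒x≡y i j∈⁅i⁆) y∈Aj

  HallCondition : ∀ {m k} → (Fin m → Subset k) → Set
  HallCondition A = ∀ X → ∣ X ∣ ≤ ∣ A ⟦ X ⟧ ∣

  record DistinctRepresentatives {m k} (A : Fin m → Subset k) : Set where
    field
      rep           : Fin m → Fin k
      rep∈          : ∀ i → rep i ∈ A i
      rep-injective : ∀ {i j} → rep i ≡ rep j → i ≡ j

  hallCondition? : ∀ {m k} (A : Fin m → Subset k) → HallCondition A ⊎ ∃ λ X → ∣ A ⟦ X ⟧ ∣ < ∣ X ∣
  hallCondition? A with anySubset? (λ X → suc ∣ A ⟦ X ⟧ ∣ ≤? ∣ X ∣)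
  ... | yes violator = inj₂ violator
  ... | no  none     = inj₁ λ X → ≮⇒≥ (λ ∣AX∣<∣X∣ → none (X , ∣AX∣<∣X∣))

  hall-≤1 : ∀ {m k} (A : Fin m → Subset k) → HallCondition A → (∀ i → ∣ A i ∣ ≤ 1) →
            DistinctRepresentatives A
  hall-≤1 {m} {k} A hallA small = record { rep = rep ; rep∈ = rep∈ ; rep-injective = injective }
    where
    nonempty : ∀ i → Nonempty (A i)
    nonempty i = 1≤∣p∣⇒Nonempty (begin
      1                  ≡⟨ sym (∣⁅x⁆∣≡1 i) ⟩
      ∣ ⁅ i ⁆ ∣          ≤⟨ hallA ⁅ i ⁆ ⟩
      ∣ A ⟦ ⁅ i ⁆ ⟧ ∣    ≤⟨ p⊆q⇒∣p∣≤∣q∣ (⟦⁅i⁆⟧⊆ A i) ⟩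
      ∣ A i ∣            ∎)
      where open ≤-Reasoning
    rep : Fin m → Fin k
    rep i = proj₁ (nonempty i)
    rep∈ : ∀ i → rep i ∈ A i
    rep∈ i = proj₂ (nonempty i)
    injective : ∀ {i j} → rep i ≡ rep j → i ≡ j
    injective {i} {j} rᵢ≡rⱼ with i Finₚ.≟ j
    ... | yes i≡j = i≡j
    ... | no  i≢j = ⊥-elim (<-irrefl refl (begin-strict
      1                         <⟨ distinct⇒2≤∣p∣ (x∈p∪q⁺ (inj₁ (x∈⁅x⁆ i))) (x∈p∪q⁺ (inj₂ (x∈⁅x⁆ j))) i≢j ⟩
      ∣ ⁅ i ⁆ ∪ ⁅ j ⁆ ∣         ≤⟨ hallA (⁅ i ⁆ ∪ ⁅ j ⁆) ⟩
      ∣ A ⟦ ⁅ i ⁆ ∪ ⁅ j ⁆ ⟧ ∣   ≤⟨ p⊆q⇒∣p∣≤∣q∣ image⊆ ⟩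
      ∣ ⁅ rep i ⁆ ∣             ≡⟨ ∣⁅x⁆∣≡1 (rep i) ⟩
      1                         ∎))
      where
      open ≤-Reasoning
      image⊆ : A ⟦ ⁅ i ⁆ ∪ ⁅ j ⁆ ⟧ ⊆ ⁅ rep i ⁆
      image⊆ y∈ with ∈⟦⟧⁻ A (⁅ i ⁆ ∪ ⁅ j ⁆) y∈
      ... | l , l∈ , y∈Al with x∈p∪q⁻ ⁅ i ⁆ ⁅ j ⁆ l∈
      ...   | inj₁ l∈⁅i⁆ rewrite x∈⁅y⁆⇒x≡y i l∈⁅i⁆ = ∣p∣≤1⇒⊆⁅x⁆ (small i) (rep∈ i) y∈Al
      ...   | inj₂ l∈⁅j⁆ rewrite x∈⁅y⁆⇒x≡y j l∈⁅j⁆ | rᵢ≡rⱼ = ∣p∣≤1⇒⊆⁅x⁆ (small j) (rep∈ j) y∈Al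

  module _ {m k} (A : Fin m → Subset k) (i : Fin m) (a : Fin k) where

    shrink : Fin m → Subset k
    shrink = updateAt A i (_- a)

    shrink⊆ : ∀ j → shrink j ⊆ A j
    shrink⊆ j with j Finₚ.≟ i
    ... | yes refl rewrite updateAt-updates i {_- a} A = p─q⊆p (A i) ⁅ a ⁆
    ... | no  j≢i  rewrite updateAt-minimal j i {_- a} A j≢i = λ y∈ → y∈

    ∈shrink⁺ : ∀ {j y} → y ∈ A j → (j ≡ i → y ≢ a) → y ∈ shrink j
    ∈shrink⁺ {j} {y} y∈Aj ok with j Finₚ.≟ i
    ... | yes refl = subst (y ∈_) (sym (updateAt-updates i A)) (x∈p∧x≢y⇒x∈p-y y∈Aj (ok refl))
    ... | no  j≢i  = subst (y ∈_) (sym (updateAt-minimal j i A j≢i)) y∈Aj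

  size : ∀ {m k} → (Fin m → Subset k) → ℕ
  size A = sum (λ i → ∣ A i ∣)

  size-shrink : ∀ {m k} (A : Fin m → Subset k) {i a} → a ∈ A i → size (shrink A i a) < size A
  size-shrink A {i} {a} a∈Ai = ∑-mono-< (λ j → p⊆q⇒∣p∣≤∣q∣ (shrink⊆ A i a j)) i
    (≤-trans (s≤s (p⊆q⇒∣p∣≤∣q∣ (shrink⊆′))) (≤-reflexive (sym (x∈p⇒∣p∣≡1+∣p-x∣ a∈Ai))))
    where
    shrink⊆′ : shrink A i a i ⊆ A i - a
    shrink⊆′ = subst (_⊆ A i - a) (sym (updateAt-updates i A)) (λ y∈ → y∈)

  module _ {m k} (A : Fin m → Subset k) (hallA : HallCondition A) (i : Fin m) where

    violator-∋ : ∀ {a X} → ∣ shrink A i a ⟦ X ⟧ ∣ < ∣ X ∣ → i ∈ X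
    violator-∋ {a} {X} violates with i ∈? X
    ... | yes i∈X = i∈X
    ... | no  i∉X = ⊥-elim (<⇒≱ violates (≤-trans (hallA X) (p⊆q⇒∣p∣≤∣q∣ (⟦⟧-mono X keep))))
      where
      keep : ∀ {j} → j ∈ X → A j ⊆ shrink A i a j
      keep j∈X y∈ = ∈shrink⁺ A i a y∈ λ { refl → ⊥-elim (i∉X j∈X) }

    -- Rado's argument: two violators for different removals would
    -- violate Hall's condition for A on their union and intersection.
    no-two-violators : ∀ {a b X Y} → a ≢ b →
      ∣ shrink A i a ⟦ X ⟧ ∣ < ∣ X ∣ → ¬ ∣ shrink A i b ⟦ Y ⟧ ∣ < ∣ Y ∣
    no-two-violators {a} {b} {X} {Y} a≢b violatesX violatesY =
      1+n≰n (begin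
        suc (suc (∣ P ∣ + ∣ Q ∣))   ≡⟨ cong suc (+-suc ∣ P ∣ ∣ Q ∣) ⟨
        suc ∣ P ∣ + suc ∣ Q ∣       ≤⟨ +-mono-≤ violatesX violatesY ⟩
        ∣ X ∣ + ∣ Y ∣               ≤⟨ counting ⟩
        suc (∣ P ∣ + ∣ Q ∣)         ∎)
      where
      open ≤-Reasoning
      P = shrink A i a ⟦ X ⟧
      Q = shrink A i b ⟦ Y ⟧
      i∈X : i ∈ X
      i∈X = violator-∋ violatesX
      i∈Y : i ∈ Y
      i∈Y = violator-∋ violatesY
      ∪⊆ : A ⟦ X ∪ Y ⟧ ⊆ P ∪ Q
      ∪⊆ {y} y∈ with ∈⟦⟧⁻ A (X ∪ Y) y∈
      ... | l , l∈X∪Y , y∈Al with l Finₚ.≟ i | y Finₚ.≟ a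
      ...   | yes refl | yes refl = x∈p∪q⁺ (inj₂ (∈⟦⟧⁺ (shrink A i b) i∈Y (∈shrink⁺ A i b y∈Al λ _ → a≢b)))
      ...   | yes refl | no  y≢a  = x∈p∪q⁺ (inj₁ (∈⟦⟧⁺ (shrink A i a) i∈X (∈shrink⁺ A i a y∈Al λ _ → y≢a)))
      ...   | no  l≢i  | _        = x∈p∪q⁺ (map
        (λ l∈X → ∈⟦⟧⁺ (shrink A i a) l∈X (∈shrink⁺ A i a y∈Al (⊥-elim ∘ l≢i)))
        (λ l∈Y → ∈⟦⟧⁺ (shrink A i b) l∈Y (∈shrink⁺ A i b y∈Al (⊥-elim ∘ l≢i)))
        (x∈p∪q⁻ X Y l∈X∪Y))
      ∩⊆ : A ⟦ (X ∩ Y) - i ⟧ ⊆ P ∩ Q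
      ∩⊆ {y} y∈ with ∈⟦⟧⁻ A ((X ∩ Y) - i) y∈
      ... | l , l∈ , y∈Al with x∈p∩q⁻ X Y (p─q⊆p (X ∩ Y) ⁅ i ⁆ l∈)
      ...   | l∈X , l∈Y = x∈p∩q⁺
        ( ∈⟦⟧⁺ (shrink A i a) l∈X (∈shrink⁺ A i a y∈Al (⊥-elim ∘ x∈p-y⇒x≢y l∈))
        , ∈⟦⟧⁺ (shrink A i b) l∈Y (∈shrink⁺ A i b y∈Al (⊥-elim ∘ x∈p-y⇒x≢y l∈)))
      counting : ∣ X ∣ + ∣ Y ∣ ≤ suc (∣ P ∣ + ∣ Q ∣)
      counting = begin
        ∣ X ∣ + ∣ Y ∣                                  ≡⟨ ∣p∪q∣+∣p∩q∣≡∣p∣+∣q∣ X Y ⟨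
        ∣ X ∪ Y ∣ + ∣ X ∩ Y ∣                          ≡⟨ cong (∣ X ∪ Y ∣ +_) (x∈p⇒∣p∣≡1+∣p-x∣ (x∈p∩q⁺ (i∈X , i∈Y))) ⟩
        ∣ X ∪ Y ∣ + suc ∣ (X ∩ Y) - i ∣                ≤⟨ +-mono-≤ (hallA (X ∪ Y)) (s≤s (hallA ((X ∩ Y) - i))) ⟩
        ∣ A ⟦ X ∪ Y ⟧ ∣ + suc ∣ A ⟦ (X ∩ Y) - i ⟧ ∣    ≤⟨ +-mono-≤ (p⊆q⇒∣p∣≤∣q∣ ∪⊆) (s≤s (p⊆q⇒∣p∣≤∣q∣ ∩⊆)) ⟩
        ∣ P ∪ Q ∣ + suc ∣ P ∩ Q ∣                      ≡⟨ +-suc _ _ ⟩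
        suc (∣ P ∪ Q ∣ + ∣ P ∩ Q ∣)                    ≡⟨ cong suc (∣p∪q∣+∣p∩q∣≡∣p∣+∣q∣ P Q) ⟩
        suc (∣ P ∣ + ∣ Q ∣)                            ∎

    hall-shrink : ∀ {a b} → a ≢ b → HallCondition (shrink A i a) ⊎ HallCondition (shrink A i b)
    hall-shrink {a} {b} a≢b with hallCondition? (shrink A i a)
    ... | inj₁ hallAa         = inj₁ hallAa
    ... | inj₂ (X , violates) = inj₂ λ Y → ≮⇒≥ (no-two-violators {X = X} {Y} a≢b violates)

  weaken : ∀ {m k} {A B : Fin m → Subset k} → (∀ i → B i ⊆ A i) →
           DistinctRepresentatives B → DistinctRepresentatives A
  weaken B⊆A R = record { rep = rep ; rep∈ = λ i → B⊆A i (rep∈ i) ; rep-injective = rep-injective }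
    where open DistinctRepresentatives R

  hall : ∀ {m k} (A : Fin m → Subset k) → HallCondition A → DistinctRepresentatives A
  hall A = hall-acc A (<-wellFounded (size A))
    where
    hall-acc : ∀ {m k} (A : Fin m → Subset k) → Acc _<_ (size A) → HallCondition A → DistinctRepresentatives A
    hall-acc A (acc smaller) hallA with Finₚ.any? (λ i → 2 ≤? ∣ A i ∣)
    ... | no  none      = hall-≤1 A hallA (λ i → ≤-pred (≰⇒> (λ 2≤ → none (i , 2≤))))
    ... | yes (i , 2≤∣Ai∣) with distinctMembers (A i) 2 2≤∣Ai∣
    ...   | g , g∈ , g-inj = [ recurse (g zero) (g∈ zero) , recurse (g (suc zero)) (g∈ (suc zero)) ]′
                               (hall-shrink A hallA i (g-inj zero (suc zero) (λ ())))
      where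
      recurse : ∀ a → a ∈ A i → HallCondition (shrink A i a) → DistinctRepresentatives A
      recurse a a∈ h = weaken (shrink⊆ A i a) (hall-acc (shrink A i a) (smaller (size-shrink A a∈)) h)

  reduce-pigeonhole : ∀ {A : Set} → AtMostTwoToOne (reduce {A = A})
  reduce-pigeonhole {a = inj₁ _} {inj₁ _} {_}     ab _  = inj₁ (cong inj₁ ab)
  reduce-pigeonhole {a = inj₂ _} {inj₂ _} {_}     ab _  = inj₁ (cong inj₂ ab)
  reduce-pigeonhole {a = inj₁ _} {inj₂ _} {inj₁ _} ab bc = inj₂ (inj₂ (cong inj₁ (trans ab bc)))
  reduce-pigeonhole {a = inj₁ _} {inj₂ _} {inj₂ _} _  bc = inj₂ (inj₁ (cong inj₂ bc))
  reduce-pigeonhole {a = inj₂ _} {inj₁ _} {inj₁ _} _  bc = inj₂ (inj₁ (cong inj₁ bc))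
  reduce-pigeonhole {a = inj₂ _} {inj₁ _} {inj₂ _} ab bc = inj₂ (inj₂ (cong inj₂ (trans ab bc)))

  ∣p++q∣≡∣p∣+∣q∣ : ∀ {m k} (p : Subset m) (q : Subset k) → ∣ p ++ q ∣ ≡ ∣ p ∣ + ∣ q ∣
  ∣p++q∣≡∣p∣+∣q∣ []            q = refl
  ∣p++q∣≡∣p∣+∣q∣ (inside ∷ p)  q = cong suc (∣p++q∣≡∣p∣+∣q∣ p q)
  ∣p++q∣≡∣p∣+∣q∣ (outside ∷ p) q = ∣p++q∣≡∣p∣+∣q∣ p q

  ∈-++⁻ : ∀ {m k} (p : Subset m) {q : Subset k} {s} → s ∈ p ++ q → [ _∈ p , _∈ q ]′ (splitAt m s)
  ∈-++⁻ []      s∈q = s∈q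
  ∈-++⁻ (_ ∷ p) {s = zero}  here = here
  ∈-++⁻ (_ ∷ p) {q = q} {s = suc s} (there s∈) = lift (splitAt _ s) (∈-++⁻ p s∈)
    where
    lift : ∀ x → [ _∈ p , _∈ q ]′ x → [ _∈ _ ∷ p , _∈ q ]′ (map₁ suc x)
    lift (inj₁ _) i∈p = there i∈p
    lift (inj₂ _) j∈q = j∈q

  ∈-++⁺ : ∀ {m k} (p : Subset m) {q : Subset k} {s} → [ _∈ p , _∈ q ]′ (splitAt m s) → s ∈ p ++ q
  ∈-++⁺ []            s∈q = s∈q
  ∈-++⁺ (inside ∷ p)  {s = zero}  _ = here
  ∈-++⁺ (_ ∷ p) {q = q} {s = suc s} s∈ = there (∈-++⁺ p (drop (splitAt _ s) s∈))
    where
    drop : ∀ x → [ _∈ _ ∷ p , _∈ q ]′ (map₁ suc x) → [ _∈ p , _∈ q ]′ x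
    drop (inj₁ _) (there i∈p) = i∈p
    drop (inj₂ _) j∈q         = j∈q

  module _ {k} (p : Subset k) {s : Fin (k + k)} where

    ∈-double⁻ : s ∈ p ++ p → reduce (splitAt k s) ∈ p
    ∈-double⁻ s∈ = merge (splitAt k s) (∈-++⁻ p s∈)
      where
      merge : ∀ x → [ _∈ p , _∈ p ]′ x → reduce x ∈ p
      merge (inj₁ _) y∈p = y∈p
      merge (inj₂ _) y∈p = y∈p

    ∈-double⁺ : reduce (splitAt k s) ∈ p → s ∈ p ++ p
    ∈-double⁺ s∈ = ∈-++⁺ p (split (splitAt k s) s∈)
      where
      split : ∀ x → reduce x ∈ p → [ _∈ p , _∈ p ]′ x
      split (inj₁ _) y∈p = y∈p
      split (inj₂ _) y∈p = y∈p

  splitAt-injective : ∀ m {n} {s t : Fin (m + n)} → splitAt m s ≡ splitAt m t → s ≡ t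
  splitAt-injective m {n} {s} {t} eq = begin
    s                       ≡⟨ Finₚ.join-splitAt m n s ⟨
    join m n (splitAt m s)  ≡⟨ cong (join m n) eq ⟩
    join m n (splitAt m t)  ≡⟨ Finₚ.join-splitAt m n t ⟩
    t                       ∎
    where open ≡-Reasoning

  -- Hall's theorem applied to two copies of the ground set.
  hall-twice : ∀ {m k} (B : Fin m → Subset k) → (∀ X → ∣ X ∣ ≤ 2 * ∣ B ⟦ X ⟧ ∣) →
               Σ (Fin m → Fin k) λ f → (∀ i → f i ∈ B i) × AtMostTwoToOne f
  hall-twice {m} {k} B hallB = f , (λ i → ∈-double⁻ (B i) (rep∈ i)) , twoToOne
    where
    A : Fin m → Subset (k + k)
    A i = B i ++ B i
    hallA : HallCondition A
    hallA X = begin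
      ∣ X ∣                          ≤⟨ hallB X ⟩
      2 * ∣ B ⟦ X ⟧ ∣                ≡⟨ cong (∣ B ⟦ X ⟧ ∣ +_) (+-identityʳ _) ⟩
      ∣ B ⟦ X ⟧ ∣ + ∣ B ⟦ X ⟧ ∣      ≡⟨ ∣p++q∣≡∣p∣+∣q∣ (B ⟦ X ⟧) (B ⟦ X ⟧) ⟨
      ∣ B ⟦ X ⟧ ++ B ⟦ X ⟧ ∣         ≤⟨ p⊆q⇒∣p∣≤∣q∣ doubled⊆ ⟩
      ∣ A ⟦ X ⟧ ∣                    ∎
      where
      open ≤-Reasoning
      doubled⊆ : B ⟦ X ⟧ ++ B ⟦ X ⟧ ⊆ A ⟦ X ⟧
      doubled⊆ s∈ with ∈⟦⟧⁻ B X (∈-double⁻ (B ⟦ X ⟧) s∈)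
      ... | i , i∈X , y∈Bi = ∈⟦⟧⁺ A i∈X (∈-double⁺ (B i) y∈Bi)
    open DistinctRepresentatives (hall A hallA)
    f : Fin m → Fin k
    f i = reduce (splitAt k (rep i))
    twoToOne : AtMostTwoToOne f
    twoToOne fa≡fb fb≡fc = map same (map same same) (reduce-pigeonhole fa≡fb fb≡fc)
      where
      same : ∀ {i j} → splitAt k (rep i) ≡ splitAt k (rep j) → i ≡ j
      same = rep-injective ∘ splitAt-injective k


module Expansion where

  open Hall
  open import Data.Bool using (Bool; true; false; if_then_else_; _∧_)
  open import Data.Fin.Subset
  open import Data.Fin.Subset.Properties
  open import Data.List using (length; filterᵇ)
  import Data.List as List
  open import Data.Vec using ([]; _∷_; tabulate; lookup)
  open import Data.Vec.Properties using (lookup∘tabulate; lookup-zipWith; []=⇒lookup; lookup⇒[]=)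
  open import Algebra.Properties.Semiring.Sum +-*-semiring using (sum; sum-cong-≗; ∑-comm; *-distribˡ-sum)

  length-filter-tabulate : ∀ {n} {A : Set} (p : A → Bool) (f : Fin n → A) →
    length (filterᵇ p (List.tabulate f)) ≡ ∣ tabulate (p ∘ f) ∣
  length-filter-tabulate {zero}  p f = refl
  length-filter-tabulate {suc n} p f with p (f zero)
  ... | true  = cong suc (length-filter-tabulate p (f ∘ suc))
  ... | false = length-filter-tabulate p (f ∘ suc)

  χ : ∀ {n} → Subset n → Fin n → ℕ
  χ p i = if lookup p i then 1 else 0

  ∣p∣≡∑χ : ∀ {n} (p : Subset n) → ∣ p ∣ ≡ sum (χ p)
  ∣p∣≡∑χ []            = refl
  ∣p∣≡∑χ (inside ∷ p)  = cong suc (∣p∣≡∑χ p)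
  ∣p∣≡∑χ (outside ∷ p) = ∣p∣≡∑χ p

  χ-∈ : ∀ {n} {p : Subset n} {i} → i ∈ p → χ p i ≡ 1
  χ-∈ i∈p rewrite []=⇒lookup i∈p = refl

  χ-∉ : ∀ {n} {p : Subset n} {i} → i ∉ p → χ p i ≡ 0
  χ-∉ {p = p} {i} i∉p with lookup p i in eq
  ... | true  = ⊥-elim (i∉p (lookup⇒[]= i p eq))
  ... | false = refl

  χ-∩ : ∀ {n} (p q : Subset n) i → χ (p ∩ q) i ≡ χ p i * χ q i
  χ-∩ p q i rewrite lookup-zipWith _∧_ i p q with lookup p i | lookup q i
  ... | true  | true  = refl
  ... | true  | false = refl
  ... | false | _     = refl

  double-counting-bound : ∀ {a t d s} → d * a ≤ s * t → s + 2 ≤ 2 * d → d ≤ t → 1 ≤ d → a + 2 ≤ 2 * t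
  double-counting-bound {a} {t} {d} {s} da≤st s+2≤2d d≤t 1≤d = *-cancelˡ-≤ d {{>-nonZero 1≤d}} (begin
    d * (a + 2)        ≡⟨ *-distribˡ-+ d a 2 ⟩
    d * a + d * 2      ≤⟨ +-mono-≤ da≤st (≤-trans (≤-reflexive (*-comm d 2)) (*-monoʳ-≤ 2 d≤t)) ⟩
    s * t + 2 * t      ≡⟨ *-distribʳ-+ t s 2 ⟨
    (s + 2) * t        ≤⟨ *-monoˡ-≤ t s+2≤2d ⟩
    2 * d * t          ≡⟨ cong (_* t) (*-comm 2 d) ⟩
    d * 2 * t          ≡⟨ *-assoc d 2 t ⟩
    d * (2 * t)        ∎)
    where open ≤-Reasoning

  module _ {n} (G : Graph n) where

    N : Fin n → Subset n
    N x = tabulate (adj G x)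

    ∈N⁺ : ∀ {x y} → Adj G x y → y ∈ N x
    ∈N⁺ {x} {y} x~y = lookup⇒[]= y (N x) (trans (lookup∘tabulate (adj G x) y) x~y)

    ∈N⁻ : ∀ {x y} → y ∈ N x → Adj G x y
    ∈N⁻ {x} {y} y∈Nx = trans (sym (lookup∘tabulate (adj G x) y)) ([]=⇒lookup y∈Nx)

    degree≡∣N∣ : ∀ x → degree G x ≡ ∣ N x ∣
    degree≡∣N∣ x = length-filter-tabulate (adj G x) (λ y → y)

    δ≤∣N∣ : ∀ {d} → MinDegreeAtLeast G d → ∀ x → d ≤ ∣ N x ∣
    δ≤∣N∣ δ≥d x = ≤-trans (δ≥d x) (≤-reflexive (degree≡∣N∣ x))

    χ-N-sym : ∀ x y → χ (N x) y ≡ χ (N y) x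
    χ-N-sym x y rewrite lookup∘tabulate (adj G x) y | lookup∘tabulate (adj G y) x | Graph.sym G x y = refl

    ∑∣N∩∣-sym : ∀ p q → sum (λ x → χ p x * ∣ N x ∩ q ∣) ≡ sum (λ y → χ q y * ∣ N y ∩ p ∣)
    ∑∣N∩∣-sym p q = begin
      sum (λ x → χ p x * ∣ N x ∩ q ∣)                         ≡⟨ sum-cong-≗ (λ x → expand p q x) ⟩
      sum (λ x → sum (λ y → χ p x * (χ (N x) y * χ q y)))     ≡⟨ ∑-comm (λ x y → χ p x * (χ (N x) y * χ q y)) ⟩
      sum (λ y → sum (λ x → χ p x * (χ (N x) y * χ q y)))     ≡⟨ sum-cong-≗ (λ y → sum-cong-≗ (λ x → swap x y)) ⟩
      sum (λ y → sum (λ x → χ q y * (χ (N y) x * χ p x)))     ≡⟨ sum-cong-≗ (λ y → expand q p y) ⟨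
      sum (λ y → χ q y * ∣ N y ∩ p ∣)                         ∎
      where
      open ≡-Reasoning
      expand : ∀ p q x → χ p x * ∣ N x ∩ q ∣ ≡ sum (λ y → χ p x * (χ (N x) y * χ q y))
      expand p q x = begin
        χ p x * ∣ N x ∩ q ∣                      ≡⟨ cong (χ p x *_) (∣p∣≡∑χ (N x ∩ q)) ⟩
        χ p x * sum (χ (N x ∩ q))                ≡⟨ cong (χ p x *_) (sum-cong-≗ (χ-∩ (N x) q)) ⟩
        χ p x * sum (λ y → χ (N x) y * χ q y)    ≡⟨ *-distribˡ-sum (χ p x) (λ y → χ (N x) y * χ q y) ⟩
        sum (λ y → χ p x * (χ (N x) y * χ q y))  ∎
      swap : ∀ x y → χ p x * (χ (N x) y * χ q y) ≡ χ q y * (χ (N y) x * χ p x)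
      swap x y rewrite χ-N-sym x y = begin
        χ p x * (χ (N y) x * χ q y)    ≡⟨ *-comm (χ p x) _ ⟩
        χ (N y) x * χ q y * χ p x      ≡⟨ cong (_* χ p x) (*-comm (χ (N y) x) (χ q y)) ⟩
        χ q y * χ (N y) x * χ p x      ≡⟨ *-assoc (χ q y) _ _ ⟩
        χ q y * (χ (N y) x * χ p x)    ∎

    Independent : Subset n → Set
    Independent Z = ∀ {x y} → x ∈ Z → y ∈ Z → ¬ Adj G x y

    K1r-free⇒∣N∩independent∣≤ : ∀ {s Z} → K1r-Free G (suc s) → Independent Z → ∀ t → ∣ N t ∩ Z ∣ ≤ s
    K1r-free⇒∣N∩independent∣≤ {s} {Z} free indep t with suc s ≤? ∣ N t ∩ Z ∣
    ... | no  s≮  = ≤-pred (≰⇒> s≮)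
    ... | yes s<  with distinctMembers (N t ∩ Z) (suc s) s<
    ...   | leaf , leaf∈ , leaf-inj = ⊥-elim (free record
      { centre     = t
      ; leaf       = leaf
      ; leaf-inj   = leaf-inj
      ; leaf-adj   = λ i → ∈N⁻ (proj₁ (x∈p∩q⁻ (N t) Z (leaf∈ i)))
      ; leaf-indep = λ i j → indep (proj₂ (x∈p∩q⁻ (N t) Z (leaf∈ i))) (proj₂ (x∈p∩q⁻ (N t) Z (leaf∈ j)))
      })

    ∑∣N∩∣≥ : ∀ {d} → MinDegreeAtLeast G d → ∀ {Z T} → (∀ {x} → x ∈ Z → N x ⊆ T) →
             d * ∣ Z ∣ ≤ sum (λ x → χ Z x * ∣ N x ∩ T ∣)
    ∑∣N∩∣≥ {d} δ≥d {Z} {T} N⊆T = begin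
      d * ∣ Z ∣                 ≡⟨ cong (d *_) (∣p∣≡∑χ Z) ⟩
      d * sum (χ Z)             ≡⟨ *-distribˡ-sum d (χ Z) ⟩
      sum (λ x → d * χ Z x)     ≤⟨ ∑-mono-≤ term ⟩
      sum (λ x → χ Z x * ∣ N x ∩ T ∣) ∎
      where
      open ≤-Reasoning
      term : ∀ x → d * χ Z x ≤ χ Z x * ∣ N x ∩ T ∣
      term x with x ∈? Z
      ... | yes x∈Z rewrite χ-∈ x∈Z = begin
        d * 1              ≡⟨ *-identityʳ d ⟩
        d                  ≤⟨ δ≤∣N∣ δ≥d x ⟩
        ∣ N x ∣            ≤⟨ p⊆q⇒∣p∣≤∣q∣ (λ y∈ → x∈p∩q⁺ (y∈ , N⊆T x∈Z y∈)) ⟩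
        ∣ N x ∩ T ∣        ≡⟨ +-identityʳ _ ⟨
        ∣ N x ∩ T ∣ + 0    ∎
      ... | no  x∉Z rewrite χ-∉ x∉Z = ≤-reflexive (*-zeroʳ d)

    ∑∣N∩independent∣≤ : ∀ {s} → K1r-Free G (suc s) → ∀ {Z} → Independent Z → ∀ T →
                         sum (λ t → χ T t * ∣ N t ∩ Z ∣) ≤ s * ∣ T ∣
    ∑∣N∩independent∣≤ {s} free {Z} indep T = begin
      sum (λ t → χ T t * ∣ N t ∩ Z ∣)  ≤⟨ ∑-mono-≤ (λ t → *-monoʳ-≤ (χ T t) (K1r-free⇒∣N∩independent∣≤ free indep t)) ⟩
      sum (λ t → χ T t * s)            ≡⟨ sum-cong-≗ (λ t → *-comm (χ T t) s) ⟩
      sum (λ t → s * χ T t)            ≡⟨ *-distribˡ-sum s (χ T) ⟨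
      s * sum (χ T)                    ≡⟨ cong (s *_) (∣p∣≡∑χ T) ⟨
      s * ∣ T ∣                        ∎
      where open ≤-Reasoning

    isolated : Subset n → Subset n
    isolated X = X ─ N ⟦ X ⟧

    N-isolated⊆ : ∀ X {x} → x ∈ isolated X → N x ⊆ N ⟦ X ⟧ ─ X
    N-isolated⊆ X x∈ y∈Nx = x∈p∧x∉q⇒x∈p─q (∈⟦⟧⁺ N (p─q⊆p X _ x∈) y∈Nx)
      (λ y∈X → x∈p─q⇒x∉q x∈ (∈⟦⟧⁺ N y∈X (∈N⁺ (Adj-sym G (∈N⁻ y∈Nx)))))

    isolated-independent : ∀ X → Independent (isolated X)
    isolated-independent X x∈ y∈ x~y = x∈p─q⇒x∉q y∈ (∈⟦⟧⁺ N (p─q⊆p X _ x∈) (∈N⁺ x~y))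

    isolated-bound : ∀ {s d} → K1r-Free G (suc s) → MinDegreeAtLeast G d → s + 2 ≤ 2 * d → 1 ≤ d →
                     ∀ X → Nonempty (isolated X) → ∣ isolated X ∣ + 2 ≤ 2 * ∣ N ⟦ X ⟧ ─ X ∣
    isolated-bound {s} {d} free δ≥d s+2≤2d 1≤d X (x , x∈) = double-counting-bound
      (begin
        d * ∣ isolated X ∣                                   ≤⟨ ∑∣N∩∣≥ δ≥d (N-isolated⊆ X) ⟩
        sum (λ x → χ (isolated X) x * ∣ N x ∩ (S ─ X) ∣)    ≡⟨ ∑∣N∩∣-sym (isolated X) (S ─ X) ⟩
        sum (λ t → χ (S ─ X) t * ∣ N t ∩ isolated X ∣)      ≤⟨ ∑∣N∩independent∣≤ free (isolated-independent X) (S ─ X) ⟩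
        s * ∣ S ─ X ∣                                        ∎)
      s+2≤2d (≤-trans (δ≤∣N∣ δ≥d x) (p⊆q⇒∣p∣≤∣q∣ (N-isolated⊆ X x∈))) 1≤d
      where
      open ≤-Reasoning
      S = N ⟦ X ⟧

    expansion : ∀ {s d} → K1r-Free G (suc s) → MinDegreeAtLeast G d → s + 2 ≤ 2 * d → 2 ≤ d →
                ∀ X → Nonempty X → ∣ X ∣ + 2 ≤ 2 * ∣ N ⟦ X ⟧ ∣
    expansion {s} {d} free δ≥d s+2≤2d 2≤d X (x , x∈X) with nonempty? (isolated X)
    ... | no  none = begin
      ∣ X ∣ + 2                          ≡⟨ cong (_+ 2) (∣p∣≡∣p─q∣+∣p∩q∣ X (N ⟦ X ⟧)) ⟩
      ∣ isolated X ∣ + ∣ X ∩ N ⟦ X ⟧ ∣ + 2  ≡⟨ cong (λ k → k + ∣ X ∩ N ⟦ X ⟧ ∣ + 2) (Empty⇒∣p∣≡0 none) ⟩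
      ∣ X ∩ N ⟦ X ⟧ ∣ + 2                ≤⟨ +-mono-≤ (∣p∩q∣≤∣q∣ X (N ⟦ X ⟧)) 2≤∣S∣ ⟩
      ∣ N ⟦ X ⟧ ∣ + ∣ N ⟦ X ⟧ ∣          ≡⟨ cong (∣ N ⟦ X ⟧ ∣ +_) (+-identityʳ _) ⟨
      2 * ∣ N ⟦ X ⟧ ∣                    ∎
      where
      open ≤-Reasoning
      2≤∣S∣ : 2 ≤ ∣ N ⟦ X ⟧ ∣
      2≤∣S∣ = ≤-trans 2≤d (≤-trans (δ≤∣N∣ δ≥d x) (p⊆q⇒∣p∣≤∣q∣ (∈⟦⟧⁺ N x∈X)))
    ... | yes some = begin
      ∣ X ∣ + 2                         ≡⟨ cong (_+ 2) (∣p∣≡∣p─q∣+∣p∩q∣ X S) ⟩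
      ∣ X ─ S ∣ + ∣ X ∩ S ∣ + 2         ≡⟨ +-assoc ∣ X ─ S ∣ _ 2 ⟩
      ∣ X ─ S ∣ + (∣ X ∩ S ∣ + 2)       ≡⟨ cong (∣ X ─ S ∣ +_) (+-comm ∣ X ∩ S ∣ 2) ⟩
      ∣ X ─ S ∣ + (2 + ∣ X ∩ S ∣)       ≡⟨ +-assoc ∣ X ─ S ∣ 2 _ ⟨
      ∣ X ─ S ∣ + 2 + ∣ X ∩ S ∣         ≤⟨ +-mono-≤ (isolated-bound free δ≥d s+2≤2d (≤-trans (s≤s z≤n) 2≤d) X some)
                                                      (m≤n*m ∣ X ∩ S ∣ 2) ⟩
      2 * ∣ S ─ X ∣ + 2 * ∣ X ∩ S ∣     ≡⟨ *-distribˡ-+ 2 ∣ S ─ X ∣ _ ⟨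
      2 * (∣ S ─ X ∣ + ∣ X ∩ S ∣)       ≡⟨ cong (λ Y → 2 * (∣ S ─ X ∣ + ∣ Y ∣)) (∩-comm X S) ⟩
      2 * (∣ S ─ X ∣ + ∣ S ∩ X ∣)       ≡⟨ cong (2 *_) (∣p∣≡∣p─q∣+∣p∩q∣ S X) ⟨
      2 * ∣ S ∣                         ∎
      where
      open ≤-Reasoning
      S = N ⟦ X ⟧

    Expanding : Set
    Expanding = ∀ X → Nonempty X → ∣ X ∣ + 2 ≤ 2 * ∣ N ⟦ X ⟧ ∣

    module _ (expanding : Expanding) {u v} (u~v : Adj G u v) where

      private
        W : Subset n
        W = ⁅ u ⁆ ∪ ⁅ v ⁆

        ∣W∣≤2 : ∣ W ∣ ≤ 2
        ∣W∣≤2 = begin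
          ∣ W ∣                                ≤⟨ m≤m+n ∣ W ∣ _ ⟩
          ∣ W ∣ + ∣ ⁅ u ⁆ ∩ ⁅ v ⁆ ∣            ≡⟨ ∣p∪q∣+∣p∩q∣≡∣p∣+∣q∣ ⁅ u ⁆ ⁅ v ⁆ ⟩
          ∣ ⁅ u ⁆ ∣ + ∣ ⁅ v ⁆ ∣                ≡⟨ cong₂ _+_ (∣⁅x⁆∣≡1 u) (∣⁅x⁆∣≡1 v) ⟩
          2                                    ∎
          where open ≤-Reasoning

        -- The edge uv is forced by offering u and v nothing but each other.
        B : Fin n → Subset n
        B x with x Finₚ.≟ u | x Finₚ.≟ v
        ... | yes _ | _     = ⁅ v ⁆
        ... | no  _ | yes _ = ⁅ u ⁆
        ... | no  _ | no  _ = N x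

        B-u : B u ≡ ⁅ v ⁆
        B-u with u Finₚ.≟ u
        ... | yes _   = refl
        ... | no  u≢u = ⊥-elim (u≢u refl)

        B-v : B v ≡ ⁅ u ⁆
        B-v with v Finₚ.≟ u | v Finₚ.≟ v
        ... | yes v≡u | _       = ⊥-elim (Adj⇒≢ G u~v (sym v≡u))
        ... | no  _   | yes _   = refl
        ... | no  _   | no  v≢v = ⊥-elim (v≢v refl)

        B-N : ∀ {x} → x ∉ W → B x ≡ N x
        B-N {x} x∉W with x Finₚ.≟ u | x Finₚ.≟ v
        ... | yes refl | _        = ⊥-elim (x∉W (x∈p∪q⁺ (inj₁ (x∈⁅x⁆ u))))
        ... | no  _    | yes refl = ⊥-elim (x∉W (x∈p∪q⁺ (inj₂ (x∈⁅x⁆ v))))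
        ... | no  _    | no  _    = refl

        B⊆N : ∀ x → B x ⊆ N x
        B⊆N x with x Finₚ.≟ u | x Finₚ.≟ v
        ... | yes refl | _        = λ y∈ → ∈N⁺ (subst (Adj G u) (sym (x∈⁅y⁆⇒x≡y v y∈)) u~v)
        ... | no  _    | yes refl = λ y∈ → ∈N⁺ (subst (Adj G v) (sym (x∈⁅y⁆⇒x≡y u y∈)) (Adj-sym G u~v))
        ... | no  _    | no  _    = λ y∈ → y∈

        B-nonempty : ∀ {x} → x ∈ W → Nonempty (B x)
        B-nonempty x∈W with x∈p∪q⁻ ⁅ u ⁆ ⁅ v ⁆ x∈W
        ... | inj₁ x∈⁅u⁆ rewrite x∈⁅y⁆⇒x≡y u x∈⁅u⁆ | B-u = v , x∈⁅x⁆ v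
        ... | inj₂ x∈⁅v⁆ rewrite x∈⁅y⁆⇒x≡y v x∈⁅v⁆ | B-v = u , x∈⁅x⁆ u

        hallB : ∀ X → ∣ X ∣ ≤ 2 * ∣ B ⟦ X ⟧ ∣
        hallB X with nonempty? (X ─ W)
        ... | yes X─W-nonempty = begin
          ∣ X ∣                          ≡⟨ ∣p∣≡∣p─q∣+∣p∩q∣ X W ⟩
          ∣ X ─ W ∣ + ∣ X ∩ W ∣          ≤⟨ +-monoʳ-≤ ∣ X ─ W ∣ (≤-trans (∣p∩q∣≤∣q∣ X W) ∣W∣≤2) ⟩
          ∣ X ─ W ∣ + 2                  ≤⟨ expanding (X ─ W) X─W-nonempty ⟩
          2 * ∣ N ⟦ X ─ W ⟧ ∣            ≤⟨ *-monoʳ-≤ 2 (p⊆q⇒∣p∣≤∣q∣ N⟦X─W⟧⊆B⟦X⟧) ⟩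
          2 * ∣ B ⟦ X ⟧ ∣                ∎
          where
          open ≤-Reasoning
          N⟦X─W⟧⊆B⟦X⟧ : N ⟦ X ─ W ⟧ ⊆ B ⟦ X ⟧
          N⟦X─W⟧⊆B⟦X⟧ y∈ with ∈⟦⟧⁻ N (X ─ W) y∈
          ... | x , x∈X─W , y∈Nx = ∈⟦⟧⁺ B (p─q⊆p X W x∈X─W)
                                     (subst (_ ∈_) (sym (B-N (x∈p─q⇒x∉q x∈X─W))) y∈Nx)
        ... | no X⊆W with nonempty? X
        ...   | no  X-empty     = ≤-trans (≤-reflexive (Empty⇒∣p∣≡0 X-empty)) z≤n
        ...   | yes (x , x∈X)   = begin
          ∣ X ∣                          ≡⟨ ∣p∣≡∣p─q∣+∣p∩q∣ X W ⟩
          ∣ X ─ W ∣ + ∣ X ∩ W ∣          ≡⟨ cong (_+ ∣ X ∩ W ∣) (Empty⇒∣p∣≡0 X⊆W) ⟩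
          ∣ X ∩ W ∣                      ≤⟨ ≤-trans (∣p∩q∣≤∣q∣ X W) ∣W∣≤2 ⟩
          2 * 1                          ≤⟨ *-monoʳ-≤ 2 (x∈p⇒1≤∣p∣ (∈⟦⟧⁺ B x∈X (proj₂ (B-nonempty x∈W)))) ⟩
          2 * ∣ B ⟦ X ⟧ ∣                ∎
          where
          open ≤-Reasoning
          x∈W : x ∈ W
          x∈W with x ∈? W
          ... | yes x∈W = x∈W
          ... | no  x∉W = ⊥-elim (X⊆W (x , x∈p∧x∉q⇒x∈p─q x∈X x∉W))

      parentMap : ParentMap G u v
      parentMap with hall-twice B hallB
      ... | f , f∈B , f-≤2 = record
        { parent     = f
        ; parent-adj = λ x → ∈N⁻ (B⊆N x (f∈B x))
        ; parent-u   = x∈⁅y⁆⇒x≡y v (subst (f u ∈_) B-u (f∈B u))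
        ; parent-v   = x∈⁅y⁆⇒x≡y u (subst (f v ∈_) B-v (f∈B v))
        ; parent-≤2  = f-≤2
        }


module Peeling where

  open import Data.Fin using (punchOut)
  open import Data.List using (List; []; _∷_; _++_; length; concat; allFin)
  open import Data.List.Properties using (length-++)
  open import Data.List.Relation.Unary.All as All using (All; []; _∷_)
  open import Data.List.Relation.Unary.Any as Any using (Any; here; there)
  open import Data.List.Relation.Unary.AllPairs as AllPairs using ([]; _∷_)
  open import Data.List.Relation.Unary.Linked using ([]; [-]; _∷_)
  open import Data.List.Relation.Unary.Unique.Propositional using (Unique)
  open import Data.List.Relation.Unary.Unique.Propositional.Properties using (allFin⁺)
  open import Data.List.Membership.Propositional using (_∈_; _∉_; find; lose)
  open import Data.List.Membership.Propositional.Properties using (∈-∃++; ∈-++⁺ʳ; ∈-++⁻; ∈-allFin)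
  import Data.List.Membership.DecPropositional as DecMembership
  open import Data.List.Relation.Binary.Permutation.Propositional using (_↭_; ↭-refl; ↭-prep; ↭-trans; ↭-sym; ↭⇒↭ₛ)
  open import Data.List.Relation.Binary.Permutation.Propositional.Properties using (shift; ∈-resp-↭; ↭-length; ++⁺ˡ)
  import Data.List.Relation.Binary.Permutation.Setoid.Properties as ↭ₛ
  open import Relation.Nullary.Decidable using (_×-dec_; _→-dec_; ¬?; map′)

  Unique-resp-↭ : ∀ {A : Set} {xs ys : List A} → xs ↭ ys → Unique xs → Unique ys
  Unique-resp-↭ {A} xs↭ys = ↭ₛ.Unique-resp-↭ (setoid A) (↭⇒↭ₛ xs↭ys)

  Unique-++⇒disjoint : ∀ {A : Set} (P : List A) {Q : List A} {y} → Unique (P ++ Q) → y ∈ P → y ∉ Q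
  Unique-++⇒disjoint (_ ∷ P) (y∉P++Q ∷ _) (here refl) y∈Q = All.lookup y∉P++Q (∈-++⁺ʳ P y∈Q) refl
  Unique-++⇒disjoint (_ ∷ P) (_ ∷ uniq)   (there y∈P) y∈Q = Unique-++⇒disjoint P uniq y∈P y∈Q

  Unique-++⁻ʳ : ∀ {A : Set} (P : List A) {Q : List A} → Unique (P ++ Q) → Unique Q
  Unique-++⁻ʳ []      uniq       = uniq
  Unique-++⁻ʳ (_ ∷ P) (_ ∷ uniq) = Unique-++⁻ʳ P uniq

  extract : ∀ {A : Set} (P : List A) {xs} → Unique xs → Unique P → All (_∈ xs) P → ∃ λ ys → xs ↭ P ++ ys
  extract []      {xs} _      _             _              = xs , ↭-refl
  extract (p ∷ P)      uniqXs (p∉P ∷ uniqP) (p∈xs ∷ P⊆xs) with ∈-∃++ p∈xs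
  ... | as , bs , refl
    with extract P (AllPairs.tail (Unique-resp-↭ (shift p as bs) uniqXs)) uniqP (All.tabulate P⊆as++bs)
    where
    P⊆as++bs : ∀ {q} → q ∈ P → q ∈ as ++ bs
    P⊆as++bs q∈P with ∈-resp-↭ (shift p as bs) (All.lookup P⊆xs q∈P)
    ... | here refl = ⊥-elim (All.lookup p∉P q∈P refl)
    ... | there q∈  = q∈
  ... | ys , perm = ys , ↭-trans (shift p as bs) (↭-prep p perm)

  empty-or-member : ∀ {A : Set} (xs : List A) → xs ≡ [] ⊎ ∃ (_∈ xs)
  empty-or-member []      = inj₁ refl
  empty-or-member (x ∷ _) = inj₂ (x , here refl)

  injective⇒surjective : ∀ {m} (ψ : Fin m → Fin m) → (∀ {a b} → ψ a ≡ ψ b → a ≡ b) → ∀ d → ¬ (∀ y → ψ y ≢ d)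
  injective⇒surjective {suc m} ψ injective d missed
    with Finₚ.pigeonhole (n<1+n m) (λ y → punchOut {i = d} {j = ψ y} (missed y ∘ sym))
  ... | i , j , i<j , eq = Finₚ.<⇒≢ i<j (injective (Finₚ.punchOut-injective (missed i ∘ sym) (missed j ∘ sym) eq))

  module _ {n} {G : Graph n} where

    path2 : ∀ {a b} → Adj G a b → PathAtLeast G 2 (a ∷ b ∷ [])
    path2 ab = record { long = s≤s (s≤s z≤n) ; linked = ab ∷ [-] }

    path3 : ∀ {a b c} → Adj G a b → Adj G b c → PathAtLeast G 2 (a ∷ b ∷ c ∷ [])
    path3 ab bc = record { long = s≤s (s≤s z≤n) ; linked = ab ∷ bc ∷ [-] }

    path4 : ∀ {a b c d} → Adj G a b → Adj G b c → Adj G c d → PathAtLeast G 2 (a ∷ b ∷ c ∷ d ∷ [])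
    path4 ab bc cd = record { long = s≤s (s≤s z≤n) ; linked = ab ∷ bc ∷ cd ∷ [-] }

  unique2 : ∀ {A : Set} {a b : A} → a ≢ b → Unique (a ∷ b ∷ [])
  unique2 ab = (ab ∷ []) ∷ [] ∷ []

  unique3 : ∀ {A : Set} {a b c : A} → a ≢ b → a ≢ c → b ≢ c → Unique (a ∷ b ∷ c ∷ [])
  unique3 ab ac bc = (ab ∷ ac ∷ []) ∷ (bc ∷ []) ∷ [] ∷ []

  unique4 : ∀ {A : Set} {a b c d : A} → a ≢ b → a ≢ c → a ≢ d → b ≢ c → b ≢ d → c ≢ d → Unique (a ∷ b ∷ c ∷ d ∷ [])
  unique4 ab ac ad bc bd cd = (ab ∷ ac ∷ ad ∷ []) ∷ (bc ∷ bd ∷ []) ∷ (cd ∷ []) ∷ [] ∷ []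

  redirect : ∀ {n} → (Fin n → Fin n) → Fin n → Fin n → Fin n → Fin n
  redirect f w t y with y Finₚ.≟ w
  ... | yes _ = t
  ... | no  _ = f y

  module _ {n} (f : Fin n → Fin n) (w t : Fin n) where

    redirect-cases : ∀ y → (y ≡ w × redirect f w t y ≡ t) ⊎ (y ≢ w × redirect f w t y ≡ f y)
    redirect-cases y with y Finₚ.≟ w
    ... | yes y≡w = inj₁ (y≡w , refl)
    ... | no  y≢w = inj₂ (y≢w , refl)

    redirect-≢ : ∀ {y} → y ≢ w → redirect f w t y ≡ f y
    redirect-≢ {y} y≢w with redirect-cases y
    ... | inj₁ (y≡w , _) = ⊥-elim (y≢w y≡w)
    ... | inj₂ (_ , eq)  = eq

    redirect-≤2 : ∀ {S : Fin n → Set} → AtMostTwoToOneOn S f →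
      (∀ {a b} → S a → a ≢ w → S b → b ≢ w → f a ≡ t → f b ≡ t → a ≡ b) →
      AtMostTwoToOneOn S (redirect f w t)
    redirect-≤2 f-≤2 t-child {a} {b} {c} a∈ b∈ c∈ ab bc
      with redirect-cases a | redirect-cases b | redirect-cases c
    ... | inj₁ (refl , _) | inj₁ (refl , _) | _               = inj₁ refl
    ... | inj₁ (refl , _) | inj₂ _          | inj₁ (refl , _) = inj₂ (inj₂ refl)
    ... | inj₂ _          | inj₁ (refl , _) | inj₁ (refl , _) = inj₂ (inj₁ refl)
    ... | inj₁ (_ , ga)   | inj₂ (b≢w , gb) | inj₂ (c≢w , gc)  =
      inj₂ (inj₁ (t-child b∈ b≢w c∈ c≢w (trans (sym gb) (trans (sym ab) ga))
                                        (trans (sym gc) (trans (sym bc) (trans (sym ab) ga)))))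
    ... | inj₂ (a≢w , ga) | inj₁ (_ , gb)   | inj₂ (c≢w , gc)  =
      inj₂ (inj₂ (t-child a∈ a≢w c∈ c≢w (trans (sym ga) (trans ab gb)) (trans (sym gc) (trans (sym bc) gb))))
    ... | inj₂ (a≢w , ga) | inj₂ (b≢w , gb) | inj₁ (_ , gc)    =
      inj₁ (t-child a∈ a≢w b∈ b≢w (trans (sym ga) (trans ab (trans bc gc))) (trans (sym gb) (trans bc gc)))
    ... | inj₂ (_ , ga)   | inj₂ (_ , gb)   | inj₂ (_ , gc)    =
      f-≤2 a∈ b∈ c∈ (trans (sym ga) (trans ab gb)) (trans (sym gb) (trans bc gc))

  module PathCovering {n} (G : Graph n) {u v : Fin n} (u~v : Adj G u v) where

    open DecMembership (Finₚ._≟_ {n}) using (_∈?_)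

    EdgeIn : List (Fin n) → Set
    EdgeIn p = EdgeOfPath u v p ⊎ EdgeOfPath v u p

    PathCover : List (Fin n) → Set
    PathCover xs = Σ (List (List (Fin n))) λ ps →
      All (PathAtLeast G 2) ps × concat ps ↭ xs × (u ∈ xs → Any EdgeIn ps)

    record Pseudoforest : Set where
      field
        vertices   : List (Fin n)
        unique     : Unique vertices
        parent     : Fin n → Fin n
        parent∈    : ∀ {x} → x ∈ vertices → parent x ∈ vertices
        parent-adj : ∀ {x} → x ∈ vertices → Adj G x (parent x)
        parent-≤2  : AtMostTwoToOneOn (_∈ vertices) parent
        parent-u   : parent u ≡ v
        parent-v   : parent v ≡ u

    CoversSmaller : Pseudoforest → Set
    CoversSmaller s = ∀ s′ → length (vertices s′) < length (vertices s) → PathCover (vertices s′)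
      where open Pseudoforest

    module Removal (s : Pseudoforest) (smaller : CoversSmaller s) where
      open Pseudoforest s

      Outside : List (Fin n) → Fin n → Set
      Outside P y = y ∈ vertices × y ∉ P

      remove : (P : List (Fin n)) → PathAtLeast G 2 P → Unique P → All (_∈ vertices) P →
        (f : Fin n → Fin n) → (∀ {y} → Outside P y → Outside P (f y)) → (∀ {y} → Outside P y → Adj G y (f y)) →
        AtMostTwoToOneOn (Outside P) f → f u ≡ v → f v ≡ u → (u ∈ P → EdgeIn P) →
        PathCover vertices
      remove P path uniqP P⊆ f f-outside f-adj f-≤2 f-u f-v edge = P ∷ ps , path ∷ ps-paths , ps↭ , covers
        where
        rest = extract P unique uniqP P⊆
        ys   = proj₁ rest
        perm : vertices ↭ P ++ ys
        perm = proj₂ rest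
        uniqP++ys : Unique (P ++ ys)
        uniqP++ys = Unique-resp-↭ perm unique
        ys⇒outside : ∀ {y} → y ∈ ys → Outside P y
        ys⇒outside y∈ys = ∈-resp-↭ (↭-sym perm) (∈-++⁺ʳ P y∈ys) , λ y∈P → Unique-++⇒disjoint P uniqP++ys y∈P y∈ys
        outside⇒ys : ∀ {y} → Outside P y → y ∈ ys
        outside⇒ys (y∈ , y∉P) with ∈-++⁻ P (∈-resp-↭ perm y∈)
        ... | inj₁ y∈P  = ⊥-elim (y∉P y∈P)
        ... | inj₂ y∈ys = y∈ys
        s′ : Pseudoforest
        s′ = record
          { vertices   = ys
          ; unique     = Unique-++⁻ʳ P uniqP++ys
          ; parent     = f
          ; parent∈    = outside⇒ys ∘ f-outside ∘ ys⇒outside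
          ; parent-adj = f-adj ∘ ys⇒outside
          ; parent-≤2  = λ a∈ b∈ c∈ → f-≤2 (ys⇒outside a∈) (ys⇒outside b∈) (ys⇒outside c∈)
          ; parent-u   = f-u
          ; parent-v   = f-v
          }
        shorter : length ys < length vertices
        shorter = ≤-trans (+-monoˡ-≤ (length ys) (≤-trans (s≤s z≤n) (PathAtLeast.long path)))
                          (≤-reflexive (sym (trans (↭-length perm) (length-++ P))))
        cover = smaller s′ shorter
        ps = proj₁ cover
        ps-paths = proj₁ (proj₂ cover)
        ps↭ : concat (P ∷ ps) ↭ vertices
        ps↭ = ↭-trans (++⁺ˡ P (proj₁ (proj₂ (proj₂ cover)))) (↭-sym perm)
        covers : u ∈ vertices → Any EdgeIn (P ∷ ps)
        covers u∈ with u ∈? P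
        ... | yes u∈P = here (edge u∈P)
        ... | no  u∉P = there (proj₂ (proj₂ (proj₂ cover)) (outside⇒ys (u∈ , u∉P)))

      remove-closed : (P : List (Fin n)) → PathAtLeast G 2 P → Unique P → All (_∈ vertices) P →
        (∀ {y} → y ∈ vertices → parent y ∈ P → y ∈ P) → (u ∈ P → EdgeIn P) → PathCover vertices
      remove-closed P path uniqP P⊆ closed =
        remove P path uniqP P⊆ parent (λ (y∈ , y∉P) → parent∈ y∈ , y∉P ∘ closed y∈) (parent-adj ∘ proj₁)
          (λ a∈ b∈ c∈ → parent-≤2 (proj₁ a∈) (proj₁ b∈) (proj₁ c∈)) parent-u parent-v

      -- The one vertex w whose parent is removed with P is re-attached to
      -- a child t of its own.
      remove-redirecting : (P : List (Fin n)) → PathAtLeast G 2 P → Unique P → All (_∈ vertices) P →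
        u ∉ vertices → ∀ {w t} → w ∈ vertices → w ∉ P → t ∈ vertices → t ∉ P → Adj G w t →
        (∀ {y} → y ∈ vertices → y ≢ w → parent y ∈ P → y ∈ P) →
        (∀ {a b} → a ∈ vertices → a ≢ w → b ∈ vertices → b ≢ w → parent a ≡ t → parent b ≡ t → a ≡ b) →
        PathCover vertices
      remove-redirecting P path uniqP P⊆ u∉ {w} {t} w∈ w∉P t∈ t∉P w~t closed t-child =
        remove P path uniqP P⊆ (redirect parent w t) outside adjacent
          (redirect-≤2 parent w t (λ a∈ b∈ c∈ → parent-≤2 (proj₁ a∈) (proj₁ b∈) (proj₁ c∈))
                                  (λ a∈ a≢w b∈ b≢w → t-child (proj₁ a∈) a≢w (proj₁ b∈) b≢w))
          (trans (redirect-≢ parent w t λ { refl → u∉ w∈ }) parent-u)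
          (trans (redirect-≢ parent w t λ { refl → u∉ (subst (_∈ vertices) parent-v (parent∈ w∈)) }) parent-v)
          (λ u∈P → ⊥-elim (u∉ (All.lookup P⊆ u∈P)))
        where
        outside : ∀ {y} → Outside P y → Outside P (redirect parent w t y)
        outside {y} (y∈ , y∉P) with redirect-cases parent w t y
        ... | inj₁ (_ , eq)   = subst (Outside P) (sym eq) (t∈ , t∉P)
        ... | inj₂ (y≢w , eq) = subst (Outside P) (sym eq) (parent∈ y∈ , y∉P ∘ closed y∈ y≢w)
        adjacent : ∀ {y} → Outside P y → Adj G y (redirect parent w t y)
        adjacent {y} (y∈ , _) with redirect-cases parent w t y
        ... | inj₁ (refl , eq) = subst (Adj G y) (sym eq) w~t
        ... | inj₂ (_ , eq)    = subst (Adj G y) (sym eq) (parent-adj y∈)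

    module Peel (s : Pseudoforest) (smaller : CoversSmaller s) where
      open Pseudoforest s
      open Removal s smaller

      Leaf : Fin n → Set
      Leaf z = All (λ y → parent y ≢ z) vertices

      leaf? : ∀ z → Dec (Leaf z)
      leaf? z = All.all? (λ y → ¬? (parent y Finₚ.≟ z)) vertices

      Child : Fin n → Fin n → Set
      Child z y = y ∈ vertices × parent y ≡ z

      childWith? : ∀ z {Q : Fin n → Set} → (∀ y → Dec (Q y)) →
                   (∃ λ y → Child z y × Q y) ⊎ (∀ {y} → Child z y → ¬ Q y)
      childWith? z Q? with Any.any? (λ y → (parent y Finₚ.≟ z) ×-dec Q? y) vertices
      ... | yes found with find found
      ...   | y , y∈ , y→z , qy = inj₁ (y , (y∈ , y→z) , qy)
      childWith? z Q? | no none = inj₂ λ (y∈ , y→z) qy → none (lose y∈ (y→z , qy))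

      hasChild? : ∀ z → Dec (∃ (Child z))
      hasChild? z = map′ find (λ (y , y∈ , y→z) → lose y∈ y→z) (Any.any? (λ y → parent y Finₚ.≟ z) vertices)

      leaf≢ : ∀ {a b} → Leaf a → ¬ Leaf b → a ≢ b
      leaf≢ leaf-a nonleaf-b refl = nonleaf-b leaf-a

      child-not-leaf : ∀ {z y} → Leaf z → ¬ Child z y
      child-not-leaf leaf-z (y∈ , y→z) = All.lookup leaf-z y∈ y→z

      nonleaf⇒child : ∀ {z} → ¬ Leaf z → ∃ (Child z)
      nonleaf⇒child {z} nonleaf with hasChild? z
      ... | yes child = child
      ... | no  none  = ⊥-elim (nonleaf (All.tabulate λ y∈ y→z → none (_ , y∈ , y→z)))

      child-adj : ∀ {z y} → Child z y → Adj G y z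
      child-adj (y∈ , refl) = parent-adj y∈

      parent-nonleaf : ∀ {y} → y ∈ vertices → ¬ Leaf (parent y)
      parent-nonleaf y∈ leaf = child-not-leaf leaf (y∈ , refl)

      u-nonleaf : u ∈ vertices → ¬ Leaf u
      u-nonleaf u∈ = subst (λ z → ¬ Leaf z) parent-v (parent-nonleaf (subst (_∈ vertices) parent-u (parent∈ u∈)))

      v-nonleaf : u ∈ vertices → ¬ Leaf v
      v-nonleaf u∈ = subst (λ z → ¬ Leaf z) parent-u (parent-nonleaf u∈)

      v-child : u ∈ vertices → Child u v
      v-child u∈ = subst (_∈ vertices) parent-u (parent∈ u∈) , parent-v

      u-child : u ∈ vertices → Child v u
      u-child u∈ = u∈ , parent-u

      Star : Fin n → Set
      Star w = ∃ (Child w) × All (λ y → parent y ≡ w → Leaf y) vertices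

      star? : ∀ w → Dec (Star w)
      star? w = hasChild? w ×-dec All.all? (λ y → (parent y Finₚ.≟ w) →-dec leaf? y) vertices

      star-leaf : ∀ {w} → Star w → ∀ {y} → Child w y → Leaf y
      star-leaf (_ , leaves) (y∈ , y→w) = All.lookup leaves y∈ y→w

      peel-star : ∀ {w} → w ∈ vertices → Star w → PathCover vertices
      peel-star {w} w∈ star@((c , c∈ , c→w) , _) with childWith? w (λ y → ¬? (y Finₚ.≟ c))
      ... | inj₁ (c′ , (c′∈ , c′→w) , c′≢c) =
        remove-closed (c ∷ w ∷ c′ ∷ [])
          (path3 (child-adj (c∈ , c→w)) (Adj-sym G (child-adj (c′∈ , c′→w))))
          (unique3 (Adj⇒≢ G (child-adj (c∈ , c→w))) (c′≢c ∘ sym) (Adj⇒≢ G (child-adj (c′∈ , c′→w)) ∘ sym))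
          (c∈ ∷ w∈ ∷ c′∈ ∷ []) closed (⊥-elim ∘ u∉)
        where
        closed : ∀ {y} → y ∈ vertices → parent y ∈ c ∷ w ∷ c′ ∷ [] → y ∈ c ∷ w ∷ c′ ∷ []
        closed y∈ (here y→c)                 = ⊥-elim (child-not-leaf (star-leaf star (c∈ , c→w)) (y∈ , y→c))
        closed y∈ (there (here y→w))         with parent-≤2 c∈ c′∈ y∈ (trans c→w (sym c′→w)) (trans c′→w (sym y→w))
        ... | inj₁ c≡c′        = ⊥-elim (c′≢c (sym c≡c′))
        ... | inj₂ (inj₁ c′≡y) = there (there (here (sym c′≡y)))
        ... | inj₂ (inj₂ c≡y)  = here (sym c≡y)
        closed y∈ (there (there (here y→c′))) = ⊥-elim (child-not-leaf (star-leaf star (c′∈ , c′→w)) (y∈ , y→c′))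
        u∉ : u ∉ c ∷ w ∷ c′ ∷ []
        u∉ (here refl)                 = u-nonleaf c∈ (star-leaf star (c∈ , c→w))
        u∉ (there (here refl))         = v-nonleaf w∈ (star-leaf star (v-child w∈))
        u∉ (there (there (here refl))) = u-nonleaf c′∈ (star-leaf star (c′∈ , c′→w))
      ... | inj₂ only-c =
        remove-closed (c ∷ w ∷ []) (path2 (child-adj (c∈ , c→w))) (unique2 (Adj⇒≢ G (child-adj (c∈ , c→w))))
          (c∈ ∷ w∈ ∷ []) closed (⊥-elim ∘ u∉)
        where
        closed : ∀ {y} → y ∈ vertices → parent y ∈ c ∷ w ∷ [] → y ∈ c ∷ w ∷ []
        closed y∈ (here y→c)         = ⊥-elim (child-not-leaf (star-leaf star (c∈ , c→w)) (y∈ , y→c))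
        closed {y} y∈ (there (here y→w)) with y Finₚ.≟ c
        ... | yes y≡c = here y≡c
        ... | no  y≢c = ⊥-elim (only-c (y∈ , y→w) y≢c)
        u∉ : u ∉ c ∷ w ∷ []
        u∉ (here refl)         = u-nonleaf c∈ (star-leaf star (c∈ , c→w))
        u∉ (there (here refl)) = v-nonleaf w∈ (star-leaf star (v-child w∈))

      leaf-child-unique : ∀ {z m y₁ y₂} → Child z m → ¬ Leaf m →
                          Child z y₁ → Leaf y₁ → Child z y₂ → Leaf y₂ → y₁ ≡ y₂
      leaf-child-unique (m∈ , m→z) nonleaf-m (y₁∈ , y₁→z) leaf-y₁ (y₂∈ , y₂→z) leaf-y₂
        with parent-≤2 m∈ y₁∈ y₂∈ (trans m→z (sym y₁→z)) (trans y₁→z (sym y₂→z))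
      ... | inj₁ m≡y₁        = ⊥-elim (leaf≢ leaf-y₁ nonleaf-m (sym m≡y₁))
      ... | inj₂ (inj₁ y₁≡y₂) = y₁≡y₂
      ... | inj₂ (inj₂ m≡y₂)  = ⊥-elim (leaf≢ leaf-y₂ nonleaf-m (sym m≡y₂))

      -- Without stars, every vertex with a child has exactly one non-leaf
      -- child, so the non-leaves form disjoint cycles of the parent map,
      -- each cycle vertex carrying at most one leaf.
      module NoStar (no-star : ¬ Any Star vertices) where

        nonleaf-child : ∀ {w c} → w ∈ vertices → Child w c → ∃ λ y → Child w y × ¬ Leaf y
        nonleaf-child {w} w∈ child with childWith? w (λ y → ¬? (leaf? y))
        ... | inj₁ found = found
        ... | inj₂ none  = ⊥-elim (no-star (lose w∈ ((_ , child) , All.tabulate leaf)))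
          where
          leaf : ∀ {y} → y ∈ vertices → parent y ≡ w → Leaf y
          leaf {y} y∈ y→w with leaf? y
          ... | yes leaf-y    = leaf-y
          ... | no  nonleaf-y = ⊥-elim (none (y∈ , y→w) nonleaf-y)

        NonLeaf : Fin n → Set
        NonLeaf z = z ∈ vertices × ¬ Leaf z

        private
          ψ-spec : ∀ z → Σ (Fin n) λ y → (NonLeaf z × parent y ≡ z × NonLeaf y) ⊎ (¬ NonLeaf z × y ≡ z)
          ψ-spec z with (z ∈? vertices) ×-dec ¬? (leaf? z)
          ... | no  ¬nonleaf             = z , inj₂ (¬nonleaf , refl)
          ... | yes nonleaf@(z∈ , ¬leaf) with nonleaf-child z∈ (proj₂ (nonleaf⇒child ¬leaf))
          ...   | y , (y∈ , y→z) , ¬leaf-y = y , inj₁ (nonleaf , y→z , y∈ , ¬leaf-y)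

          ψ : Fin n → Fin n
          ψ z = proj₁ (ψ-spec z)

          ψ-injective : ∀ {a b} → ψ a ≡ ψ b → a ≡ b
          ψ-injective {a} {b} ψa≡ψb with ψ-spec a | ψ-spec b
          ... | _ , inj₁ (_ , a′→a , _)  | _ , inj₁ (_ , b′→b , _)  = trans (sym a′→a) (trans (cong parent ψa≡ψb) b′→b)
          ... | _ , inj₁ (_ , _ , nl)    | _ , inj₂ (¬nl , b′≡b)    = ⊥-elim (¬nl (subst NonLeaf (trans ψa≡ψb b′≡b) nl))
          ... | _ , inj₂ (¬nl , a′≡a)    | _ , inj₁ (_ , _ , nl)    =
            ⊥-elim (¬nl (subst NonLeaf (trans (sym ψa≡ψb) a′≡a) nl))
          ... | _ , inj₂ (_ , a′≡a)      | _ , inj₂ (_ , b′≡b)      = trans (sym a′≡a) (trans ψa≡ψb b′≡b)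

        -- A second non-leaf child of z would be missed by the injection ψ.
        nonleaf-child-unique : ∀ {z c₁ c₂} → Child z c₁ → ¬ Leaf c₁ → Child z c₂ → ¬ Leaf c₂ → c₁ ≡ c₂
        nonleaf-child-unique {z} {c₁} {c₂} (c₁∈ , c₁→z) ¬leaf₁ (c₂∈ , c₂→z) ¬leaf₂ with c₁ Finₚ.≟ c₂
        ... | yes c₁≡c₂ = c₁≡c₂
        ... | no  c₁≢c₂ = ⊥-elim (injective⇒surjective ψ ψ-injective d missed)
          where
          d-spec : Σ (Fin n) λ d → NonLeaf d × parent d ≡ z × d ≢ ψ z
          d-spec with ψ z Finₚ.≟ c₁
          ... | yes ψz≡c₁ = c₂ , (c₂∈ , ¬leaf₂) , c₂→z , λ c₂≡ψz → c₁≢c₂ (trans (sym ψz≡c₁) (sym c₂≡ψz))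
          ... | no  ψz≢c₁ = c₁ , (c₁∈ , ¬leaf₁) , c₁→z , ψz≢c₁ ∘ sym
          d = proj₁ d-spec
          missed : ∀ y → ψ y ≢ d
          missed y ψy≡d with proj₂ (ψ-spec y) | proj₂ d-spec
          ... | inj₁ (_ , ψy→y , _)  | _ , d→z , d≢ψz =
            d≢ψz (trans (sym ψy≡d) (cong ψ (trans (sym ψy→y) (trans (cong parent ψy≡d) d→z))))
          ... | inj₂ (¬nl , ψy≡y)    | nl-d , _       = ¬nl (subst NonLeaf (sym (trans (sym ψy≡y) ψy≡d)) nl-d)

        child-cases : ∀ {z m y} → Child z m → ¬ Leaf m → Child z y → y ≡ m ⊎ Leaf y
        child-cases child-m ¬leaf-m child-y with leaf? _
        ... | yes leaf-y = inj₂ leaf-y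
        ... | no  ¬leaf-y = inj₁ (nonleaf-child-unique child-y ¬leaf-y child-m ¬leaf-m)

        kids-with-leaf : ∀ {z m a y} → Child z m → ¬ Leaf m → Child z a → Leaf a → Child z y → y ≡ m ⊎ y ≡ a
        kids-with-leaf m-child ¬leaf-m a-child leaf-a y-child with child-cases m-child ¬leaf-m y-child
        ... | inj₁ y≡m    = inj₁ y≡m
        ... | inj₂ leaf-y = inj₂ (leaf-child-unique m-child ¬leaf-m y-child leaf-y a-child leaf-a)

        kids-without-leaf : ∀ {z m y} → Child z m → ¬ Leaf m → (∀ {y} → Child z y → ¬ Leaf y) → Child z y → y ≡ m
        kids-without-leaf m-child ¬leaf-m no-leaf y-child with child-cases m-child ¬leaf-m y-child
        ... | inj₁ y≡m    = y≡m
        ... | inj₂ leaf-y = ⊥-elim (no-leaf y-child leaf-y)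

        module _ (u∈ : u ∈ vertices) where
          private
            v∈ : v ∈ vertices
            v∈ = proj₁ (v-child u∈)
            ¬leaf-u : ¬ Leaf u
            ¬leaf-u = u-nonleaf u∈
            ¬leaf-v : ¬ Leaf v
            ¬leaf-v = v-nonleaf u∈
            NoLeafChild : Fin n → Set
            NoLeafChild z = ∀ {y} → Child z y → ¬ Leaf y
            u-kids : ∀ {a y} → Child u a → Leaf a → Child u y → y ≡ v ⊎ y ≡ a
            u-kids = kids-with-leaf (v-child u∈) ¬leaf-v
            v-kids : ∀ {b y} → Child v b → Leaf b → Child v y → y ≡ u ⊎ y ≡ b
            v-kids = kids-with-leaf (u-child u∈) ¬leaf-u
            u-kid : ∀ {y} → NoLeafChild u → Child u y → y ≡ v
            u-kid = kids-without-leaf (v-child u∈) ¬leaf-v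
            v-kid : ∀ {y} → NoLeafChild v → Child v y → y ≡ u
            v-kid = kids-without-leaf (u-child u∈) ¬leaf-u

          peel-a-u-v-b : ∀ {a b} → Child u a → Leaf a → Child v b → Leaf b → PathCover vertices
          peel-a-u-v-b {a} {b} a-child leaf-a b-child leaf-b =
            remove-closed (a ∷ u ∷ v ∷ b ∷ []) (path4 (child-adj a-child) u~v (Adj-sym G (child-adj b-child)))
              (unique4 (Adj⇒≢ G (child-adj a-child)) (leaf≢ leaf-a ¬leaf-v)
                       (λ a≡b → Adj⇒≢ G u~v (trans (sym (proj₂ a-child)) (trans (cong parent a≡b) (proj₂ b-child))))
                       (Adj⇒≢ G u~v) (leaf≢ leaf-b ¬leaf-u ∘ sym) (Adj⇒≢ G (child-adj b-child) ∘ sym))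
              (proj₁ a-child ∷ u∈ ∷ v∈ ∷ proj₁ b-child ∷ []) closed (λ _ → inj₁ (a ∷ [] , b ∷ [] , refl))
            where
            closed : ∀ {y} → y ∈ vertices → parent y ∈ a ∷ u ∷ v ∷ b ∷ [] → y ∈ a ∷ u ∷ v ∷ b ∷ []
            closed y∈ (here y→a)                 = ⊥-elim (child-not-leaf leaf-a (y∈ , y→a))
            closed y∈ (there (here y→u))         =
              [ there ∘ there ∘ here , here ]′ (u-kids a-child leaf-a (y∈ , y→u))
            closed y∈ (there (there (here y→v))) =
              [ there ∘ here , there ∘ there ∘ there ∘ here ]′ (v-kids b-child leaf-b (y∈ , y→v))
            closed y∈ (there (there (there (here y→b)))) = ⊥-elim (child-not-leaf leaf-b (y∈ , y→b))

          peel-a-u-v : ∀ {a} → Child u a → Leaf a → NoLeafChild v → PathCover vertices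
          peel-a-u-v {a} a-child leaf-a no-leaf-v =
            remove-closed (a ∷ u ∷ v ∷ []) (path3 (child-adj a-child) u~v)
              (unique3 (Adj⇒≢ G (child-adj a-child)) (leaf≢ leaf-a ¬leaf-v) (Adj⇒≢ G u~v))
              (proj₁ a-child ∷ u∈ ∷ v∈ ∷ []) closed (λ _ → inj₁ (a ∷ [] , [] , refl))
            where
            closed : ∀ {y} → y ∈ vertices → parent y ∈ a ∷ u ∷ v ∷ [] → y ∈ a ∷ u ∷ v ∷ []
            closed y∈ (here y→a)                 = ⊥-elim (child-not-leaf leaf-a (y∈ , y→a))
            closed y∈ (there (here y→u))         =
              [ there ∘ there ∘ here , here ]′ (u-kids a-child leaf-a (y∈ , y→u))
            closed y∈ (there (there (here y→v))) = there (here (v-kid no-leaf-v (y∈ , y→v)))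

          peel-u-v-b : ∀ {b} → NoLeafChild u → Child v b → Leaf b → PathCover vertices
          peel-u-v-b {b} no-leaf-u b-child leaf-b =
            remove-closed (u ∷ v ∷ b ∷ []) (path3 u~v (Adj-sym G (child-adj b-child)))
              (unique3 (Adj⇒≢ G u~v) (leaf≢ leaf-b ¬leaf-u ∘ sym) (Adj⇒≢ G (child-adj b-child) ∘ sym))
              (u∈ ∷ v∈ ∷ proj₁ b-child ∷ []) closed (λ _ → inj₁ ([] , b ∷ [] , refl))
            where
            closed : ∀ {y} → y ∈ vertices → parent y ∈ u ∷ v ∷ b ∷ [] → y ∈ u ∷ v ∷ b ∷ []
            closed y∈ (here y→u)                 = there (here (u-kid no-leaf-u (y∈ , y→u)))
            closed y∈ (there (here y→v))         =
              [ here , there ∘ there ∘ here ]′ (v-kids b-child leaf-b (y∈ , y→v))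
            closed y∈ (there (there (here y→b))) = ⊥-elim (child-not-leaf leaf-b (y∈ , y→b))

          peel-u-v : NoLeafChild u → NoLeafChild v → PathCover vertices
          peel-u-v no-leaf-u no-leaf-v =
            remove-closed (u ∷ v ∷ []) (path2 u~v) (unique2 (Adj⇒≢ G u~v)) (u∈ ∷ v∈ ∷ []) closed
              (λ _ → inj₁ ([] , [] , refl))
            where
            closed : ∀ {y} → y ∈ vertices → parent y ∈ u ∷ v ∷ [] → y ∈ u ∷ v ∷ []
            closed y∈ (here y→u)         = there (here (u-kid no-leaf-u (y∈ , y→u)))
            closed y∈ (there (here y→v)) = here (v-kid no-leaf-v (y∈ , y→v))

          peel-edge : PathCover vertices
          peel-edge with childWith? u leaf? | childWith? v leaf?
          ... | inj₁ (_ , a-child , leaf-a) | inj₁ (_ , b-child , leaf-b) = peel-a-u-v-b a-child leaf-a b-child leaf-b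
          ... | inj₁ (_ , a-child , leaf-a) | inj₂ no-leaf-v              = peel-a-u-v a-child leaf-a no-leaf-v
          ... | inj₂ no-leaf-u              | inj₁ (_ , b-child , leaf-b) = peel-u-v-b no-leaf-u b-child leaf-b
          ... | inj₂ no-leaf-u              | inj₂ no-leaf-v              = peel-u-v no-leaf-u no-leaf-v

        module _ (u∉ : u ∉ vertices) {ℓ} (ℓ∈ : ℓ ∈ vertices) (leaf-ℓ : Leaf ℓ) where
          private
            p  = parent ℓ
            p∈ = parent∈ ℓ∈
            c-spec = nonleaf-child p∈ (ℓ∈ , refl)
            c = proj₁ c-spec
            c-child : Child p c
            c-child = proj₁ (proj₂ c-spec)
            c∈ = proj₁ c-child
            ¬leaf-c : ¬ Leaf c
            ¬leaf-c = proj₂ (proj₂ c-spec)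
            b-spec = nonleaf-child c∈ (proj₂ (nonleaf⇒child ¬leaf-c))
            b = proj₁ b-spec
            b-child : Child c b
            b-child = proj₁ (proj₂ b-spec)
            b∈ = proj₁ b-child
            ¬leaf-b : ¬ Leaf b
            ¬leaf-b = proj₂ (proj₂ b-spec)

            ℓ~p : Adj G ℓ p
            ℓ~p = parent-adj ℓ∈
            p~c : Adj G p c
            p~c = Adj-sym G (child-adj c-child)
            ℓ≢c : ℓ ≢ c
            ℓ≢c = leaf≢ leaf-ℓ ¬leaf-c

            p-kids : ∀ {y} → Child p y → y ≡ c ⊎ y ≡ ℓ
            p-kids = kids-with-leaf c-child ¬leaf-c (ℓ∈ , refl) leaf-ℓ

            ℓp-closed : ∀ {y} → y ∈ vertices → y ≢ c → parent y ∈ ℓ ∷ p ∷ [] → y ∈ ℓ ∷ p ∷ []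
            ℓp-closed y∈ y≢c (here y→ℓ) = ⊥-elim (child-not-leaf leaf-ℓ (y∈ , y→ℓ))
            ℓp-closed y∈ y≢c (there (here y→p)) = [ ⊥-elim ∘ y≢c , here ]′ (p-kids (y∈ , y→p))

            c∉ℓp : c ∉ ℓ ∷ p ∷ []
            c∉ℓp (here c≡ℓ)         = ℓ≢c (sym c≡ℓ)
            c∉ℓp (there (here c≡p)) = Adj⇒≢ G p~c (sym c≡p)

            ℓpc-closed : (∀ {y} → Child c y → ¬ Leaf y) → ∀ {y} → y ∈ vertices → (y ≡ b → b ≡ p) →
                         parent y ∈ ℓ ∷ p ∷ c ∷ [] → y ∈ ℓ ∷ p ∷ c ∷ []
            ℓpc-closed _ y∈ _ (here y→ℓ) = ⊥-elim (child-not-leaf leaf-ℓ (y∈ , y→ℓ))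
            ℓpc-closed _ y∈ _ (there (here y→p)) = [ there ∘ there ∘ here , here ]′ (p-kids (y∈ , y→p))
            ℓpc-closed no-leaf-c y∈ b≡p (there (there (here y→c))) =
              there (here (trans y≡b (b≡p y≡b)))
              where y≡b = kids-without-leaf b-child ¬leaf-b no-leaf-c (y∈ , y→c)

          peel-leaf : PathCover vertices
          peel-leaf with childWith? c leaf?
          ... | inj₁ (ℓc , ℓc-child , leaf-ℓc) =
            remove-redirecting (ℓ ∷ p ∷ []) (path2 ℓ~p) (unique2 (Adj⇒≢ G ℓ~p)) (ℓ∈ ∷ p∈ ∷ []) u∉
              c∈ c∉ℓp (proj₁ ℓc-child) ℓc∉ℓp (Adj-sym G (child-adj ℓc-child)) ℓp-closed
              (λ a∈ _ _ _ a→ℓc _ → ⊥-elim (child-not-leaf leaf-ℓc (a∈ , a→ℓc)))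
            where
            ℓc∉ℓp : ℓc ∉ ℓ ∷ p ∷ []
            ℓc∉ℓp (here ℓc≡ℓ)         = Adj⇒≢ G p~c (trans (sym (cong parent ℓc≡ℓ)) (proj₂ ℓc-child))
            ℓc∉ℓp (there (here ℓc≡p)) = leaf≢ leaf-ℓc (parent-nonleaf ℓ∈) ℓc≡p
          ... | inj₂ no-leaf-c with b Finₚ.≟ p
          ...   | yes b≡p =
            remove-closed (ℓ ∷ p ∷ c ∷ []) (path3 ℓ~p p~c) (unique3 (Adj⇒≢ G ℓ~p) ℓ≢c (Adj⇒≢ G p~c))
              (ℓ∈ ∷ p∈ ∷ c∈ ∷ []) (λ y∈ → ℓpc-closed no-leaf-c y∈ (λ _ → b≡p))
              (⊥-elim ∘ u∉ ∘ All.lookup (ℓ∈ ∷ p∈ ∷ c∈ ∷ []))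
          ...   | no  b≢p with childWith? b leaf?
          ...     | inj₁ (ℓb , ℓb-child , leaf-ℓb) =
            remove-redirecting (ℓ ∷ p ∷ c ∷ []) (path3 ℓ~p p~c) (unique3 (Adj⇒≢ G ℓ~p) ℓ≢c (Adj⇒≢ G p~c))
              (ℓ∈ ∷ p∈ ∷ c∈ ∷ []) u∉ b∈ b∉ (proj₁ ℓb-child) ℓb∉ (Adj-sym G (child-adj ℓb-child))
              (λ y∈ y≢b → ℓpc-closed no-leaf-c y∈ (⊥-elim ∘ y≢b))
              (λ a∈ _ _ _ a→ℓb _ → ⊥-elim (child-not-leaf leaf-ℓb (a∈ , a→ℓb)))
            where
            b∉ : b ∉ ℓ ∷ p ∷ c ∷ []
            b∉ (here b≡ℓ)                 = leaf≢ leaf-ℓ ¬leaf-b (sym b≡ℓ)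
            b∉ (there (here b≡p))         = b≢p b≡p
            b∉ (there (there (here b≡c))) = Adj⇒≢ G (child-adj b-child) b≡c
            ℓb∉ : ℓb ∉ ℓ ∷ p ∷ c ∷ []
            ℓb∉ (here ℓb≡ℓ)                 = b≢p (trans (sym (proj₂ ℓb-child)) (cong parent ℓb≡ℓ))
            ℓb∉ (there (here ℓb≡p))         = leaf≢ leaf-ℓb (parent-nonleaf ℓ∈) ℓb≡p
            ℓb∉ (there (there (here ℓb≡c))) = leaf≢ leaf-ℓb ¬leaf-c ℓb≡c
          ...     | inj₂ no-leaf-b =
            remove-redirecting (ℓ ∷ p ∷ []) (path2 ℓ~p) (unique2 (Adj⇒≢ G ℓ~p)) (ℓ∈ ∷ p∈ ∷ []) u∉
              c∈ c∉ℓp b∈ b∉ℓp (Adj-sym G (child-adj b-child)) ℓp-closed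
              (λ a∈ _ a′∈ _ a→b a′→b →
                nonleaf-child-unique (a∈ , a→b) (no-leaf-b (a∈ , a→b)) (a′∈ , a′→b) (no-leaf-b (a′∈ , a′→b)))
            where
            b∉ℓp : b ∉ ℓ ∷ p ∷ []
            b∉ℓp (here b≡ℓ)         = leaf≢ leaf-ℓ ¬leaf-b (sym b≡ℓ)
            b∉ℓp (there (here b≡p)) = b≢p b≡p

        -- Without leaves the parent map permutes the vertices.
        module _ (u∉ : u ∉ vertices) (no-leaf : ¬ Any Leaf vertices) {x} (x∈ : x ∈ vertices) where
          private
            nonleaf : ∀ {z} → z ∈ vertices → ¬ Leaf z
            nonleaf z∈ leaf-z = no-leaf (lose z∈ leaf-z)
            child-unique : ∀ {z y₁ y₂} → Child z y₁ → Child z y₂ → y₁ ≡ y₂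
            child-unique c₁@(y₁∈ , _) c₂@(y₂∈ , _) = nonleaf-child-unique c₁ (nonleaf y₁∈) c₂ (nonleaf y₂∈)
            y  = parent x
            y∈ = parent∈ x∈
            z  = parent y
            x≢y : x ≢ y
            x≢y = Adj⇒≢ G (parent-adj x∈)
            w-spec = nonleaf⇒child (nonleaf x∈)
            w = proj₁ w-spec
            w-child : Child x w
            w-child = proj₂ w-spec
            w∈ = proj₁ w-child
            t-spec = nonleaf⇒child (nonleaf w∈)
            t = proj₁ t-spec
            t-child : Child w t
            t-child = proj₂ t-spec

          peel-cycle : PathCover vertices
          peel-cycle with z Finₚ.≟ x
          ... | yes z≡x =
            remove-closed (x ∷ y ∷ []) (path2 (parent-adj x∈)) (unique2 x≢y) (x∈ ∷ y∈ ∷ []) closed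
              (⊥-elim ∘ u∉ ∘ All.lookup (x∈ ∷ y∈ ∷ []))
            where
            closed : ∀ {q} → q ∈ vertices → parent q ∈ x ∷ y ∷ [] → q ∈ x ∷ y ∷ []
            closed q∈ (here q→x)         = there (here (child-unique (q∈ , q→x) (y∈ , z≡x)))
            closed q∈ (there (here q→y)) = here (child-unique (q∈ , q→y) (x∈ , refl))
          ... | no z≢x with w Finₚ.≟ z
          ...   | yes w≡z =
            remove-closed (x ∷ y ∷ z ∷ []) (path3 (parent-adj x∈) (parent-adj y∈))
              (unique3 x≢y (z≢x ∘ sym) (Adj⇒≢ G (parent-adj y∈))) (x∈ ∷ y∈ ∷ parent∈ y∈ ∷ []) closed
              (⊥-elim ∘ u∉ ∘ All.lookup (x∈ ∷ y∈ ∷ parent∈ y∈ ∷ []))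
            where
            closed : ∀ {q} → q ∈ vertices → parent q ∈ x ∷ y ∷ z ∷ [] → q ∈ x ∷ y ∷ z ∷ []
            closed q∈ (here q→x)                 = there (there (here (trans (child-unique (q∈ , q→x) w-child) w≡z)))
            closed q∈ (there (here q→y))         = here (child-unique (q∈ , q→y) (x∈ , refl))
            closed q∈ (there (there (here q→z))) = there (here (child-unique (q∈ , q→z) (y∈ , refl)))
          ...   | no  w≢z =
            remove-redirecting (x ∷ y ∷ []) (path2 (parent-adj x∈)) (unique2 x≢y) (x∈ ∷ y∈ ∷ []) u∉
              w∈ w∉ (proj₁ t-child) t∉ (Adj-sym G (child-adj t-child)) closed
              (λ a∈ _ b∈ _ a→t b→t → child-unique (a∈ , a→t) (b∈ , b→t))
            where
            closed : ∀ {q} → q ∈ vertices → q ≢ w → parent q ∈ x ∷ y ∷ [] → q ∈ x ∷ y ∷ []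
            closed q∈ q≢w (here q→x)         = ⊥-elim (q≢w (child-unique (q∈ , q→x) w-child))
            closed q∈ q≢w (there (here q→y)) = here (child-unique (q∈ , q→y) (x∈ , refl))
            w∉ : w ∉ x ∷ y ∷ []
            w∉ (here w≡x)         = Adj⇒≢ G (child-adj w-child) w≡x
            w∉ (there (here w≡y)) = z≢x (trans (cong parent (sym w≡y)) (proj₂ w-child))
            t∉ : t ∉ x ∷ y ∷ []
            t∉ (here t≡x)         = w∉ (there (here (trans (sym (proj₂ t-child)) (cong parent t≡x))))
            t∉ (there (here t≡y)) = w≢z (trans (sym (proj₂ t-child)) (cong parent t≡y))

      peel : PathCover vertices
      peel with Any.any? star? vertices
      ... | yes has-star = let _ , w∈ , star = find has-star in peel-star w∈ star
      ... | no  no-star with u ∈? vertices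
      ...   | yes u∈ = NoStar.peel-edge no-star u∈
      ...   | no  u∉ with Any.any? leaf? vertices
      ...     | yes has-leaf = let _ , ℓ∈ , leaf-ℓ = find has-leaf in NoStar.peel-leaf no-star u∉ ℓ∈ leaf-ℓ
      ...     | no  no-leaf with empty-or-member vertices
      ...       | inj₁ empty    = [] , [] , subst ([] ↭_) (sym empty) ↭-refl , ⊥-elim ∘ u∉
      ...       | inj₂ (_ , x∈) = NoStar.peel-cycle no-star u∉ no-leaf x∈

    pathCover : (s : Pseudoforest) → PathCover (Pseudoforest.vertices s)
    pathCover s = go s (<-wellFounded _)
      where
      go : (s : Pseudoforest) → Acc _<_ (length (Pseudoforest.vertices s)) → PathCover (Pseudoforest.vertices s)
      go s (acc smaller) = Peel.peel s λ s′ shorter → go s′ (smaller shorter)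

  pathFactor : ∀ {n} {G : Graph n} {u v} (u~v : Adj G u v) → ParentMap G u v →
               Σ (PathFactor G 2) λ F → FactorContainsEdge F u v
  pathFactor {n} {G} u~v P = factor , proj₂ (proj₂ (proj₂ cover)) (∈-allFin _)
    where
    open ParentMap P
    open PathCovering G u~v
    cover = pathCover record
      { vertices   = allFin n
      ; unique     = allFin⁺ n
      ; parent     = parent
      ; parent∈    = λ _ → ∈-allFin _
      ; parent-adj = λ {x} _ → parent-adj x
      ; parent-≤2  = λ _ _ _ → parent-≤2
      ; parent-u   = parent-u
      ; parent-v   = parent-v
      }
    factor : PathFactor G 2
    factor = record { paths = proj₁ cover ; valid = proj₁ (proj₂ cover) ; spanning = proj₁ (proj₂ (proj₂ cover)) }

open Expansion using (expansion; parentMap)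
open Peeling using (pathFactor)

s+2≤2*[[1+s]/2+1] : ∀ s → s + 2 ≤ 2 * (suc s / 2 + 1)
s+2≤2*[[1+s]/2+1] s = begin
  s + 2                          ≡⟨ +-comm s 2 ⟩
  suc (suc s)                    ≡⟨ cong suc (m≡m%n+[m/n]*n (suc s) 2) ⟩
  suc (suc s % 2 + h * 2)        ≤⟨ s≤s (+-monoˡ-≤ (h * 2) (≤-pred (m%n<n (suc s) 2))) ⟩
  suc (1 + h * 2)                ≡⟨ cong (2 +_) (*-comm h 2) ⟩
  2 + 2 * h                      ≡⟨ +-comm 2 (2 * h) ⟩
  2 * h + 2                      ≡⟨ *-distribˡ-+ 2 h 1 ⟨
  2 * (h + 1)                    ∎
  where
  open ≤-Reasoning
  h = suc s / 2

3≤r⇒2≤r/2+1 : ∀ {r} → 3 ≤ r → 2 ≤ r / 2 + 1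
3≤r⇒2≤r/2+1 3≤r = +-monoˡ-≤ 1 (/-monoˡ-≤ 2 3≤r)

theorem8 : (r : ℕ) → 3 ≤ r → (n : ℕ) → (G : Graph n) →
    K1r-Free G r → MinDegreeAtLeast G (r / 2 + 1) → FactorCovered G 2
theorem8 (suc s) 3≤r n G free δ≥ u v u~v =
  pathFactor u~v (parentMap G (expansion G free δ≥ (s+2≤2*[[1+s]/2+1] s) (3≤r⇒2≤r/2+1 3≤r)) u~v)
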